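{- Let $k$ be a finite field of characteristic $\ell$, $V$ a finite-dimensional $k$-vector space and $G\subset\mathrm{GL}(V)$ a subgroup. Then $G$ is big if and only if $k^\times G$ is big, where $k^\times$ denotes the group of scalar matrices in $\mathrm{GL}(V)$.
   Context: For $g\in\mathrm{End}(V)$ and $\alpha\in k$, $V_{g,\alpha}$ is the generalized $\alpha$-eigenspace of $g$. $\mathrm{ad}\,V=\mathrm{End}(V)$, $\mathrm{ad}^\circ V$ its trace-zero subspace, with conjugation action. A subgroup $G\subset\mathrm{GL}(V)$ is big if: (B1) $G$ has no non-trivial quotient of $\ell$-power order; (B2) $V$ is absolutely irreducible as a $G$-module; (B3) $H^1(G,\mathrm{ad}^\circ V)=0$; (B4) for every irreducible $G$-submodule $W$ of $\mathrm{ad}\,V$ there exist $g\in G$, $\alpha\in k$, $f\in W$ such that $V_{g,\alpha}$ is one-dimensional and the composite $V_{g,\alpha}\hookrightarrow V\xrightarrow{f}V\twoheadrightarrow V_{g,\alpha}$ is non-zero. -}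

module Defs where

open import Level using (Level; _⊔_) renaming (suc to lsuc)
open import Data.Nat using (ℕ; zero; suc; _^_; _≤_)
open import Data.Nat.Primality using (Prime)
open import Data.Fin using (Fin)
import Data.Fin as F
open import Data.Product using (Σ; _×_; _,_; ∃)
open import Data.Sum using (_⊎_)
open import Relation.Nullary using (¬_)
open import Relation.Binary.PropositionalEquality using (_≡_)
import Relation.Binary.PropositionalEquality as ≡
open import Function.Bundles using (Inverse)
open import Algebra.Bundles using (CommutativeRing)
open import Algebra.Structures using (IsGroup)
open import Algebra.Morphism.Structures using (module RingMorphisms)

record Field (c ℓ : Level) : Set (lsuc (c ⊔ ℓ)) where
  field
    commutativeRing : CommutativeRing c ℓ
  open CommutativeRing commutativeRing public
  field
    0≉1     : ¬ (0# ≈ 1#)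
    inverse : ∀ x → ¬ (x ≈ 0#) → Σ Carrier λ y → x * y ≈ 1#

module _ {c ℓ : Level} (k : Field c ℓ) where
  open Field k

  IsFinite : Set (c ⊔ ℓ)
  IsFinite = Σ ℕ λ q → Inverse setoid (≡.setoid (Fin q))

  ℕ→k : ℕ → Carrier
  ℕ→k zero    = 0#
  ℕ→k (suc m) = 1# + ℕ→k m

  HasChar : ℕ → Set ℓ
  HasChar p = Prime p × (ℕ→k p ≈ 0#)

module Lin {c ℓ : Level} (R : CommutativeRing c ℓ) (n : ℕ) where
  open CommutativeRing R

  sumF : ∀ {m} → (Fin m → Carrier) → Carrier
  sumF {zero}  f = 0#
  sumF {suc m} f = f F.zero + sumF (λ i → f (F.suc i))

  Vect : Set c
  Vect = Fin n → Carrier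

  Mat : Set c
  Mat = Fin n → Fin n → Carrier

  _≈v_ : Vect → Vect → Set ℓ
  u ≈v v = ∀ i → u i ≈ v i

  _≈m_ : Mat → Mat → Set ℓ
  M ≈m N = ∀ i j → M i j ≈ N i j

  0v : Vect
  0v i = 0#

  _+v_ : Vect → Vect → Vect
  (u +v v) i = u i + v i

  _-v_ : Vect → Vect → Vect
  (u -v v) i = u i - v i

  _·v_ : Carrier → Vect → Vect
  (a ·v v) i = a * v i

  0m : Mat
  0m i j = 0#

  1m : Mat
  1m i j with i F.≟ j
  ... | Relation.Nullary.yes _ = 1#
  ... | Relation.Nullary.no _  = 0#

  _+m_ : Mat → Mat → Mat
  (M +m N) i j = M i j + N i j

  _-m_ : Mat → Mat → Mat
  (M -m N) i j = M i j - N i j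

  _·m_ : Carrier → Mat → Mat
  (a ·m M) i j = a * M i j

  _*m_ : Mat → Mat → Mat
  (M *m N) i j = sumF (λ l → M i l * N l j)

  _$_ : Mat → Vect → Vect
  (M $ v) i = sumF (λ j → M i j * v j)

  _^m_ : Mat → ℕ → Mat
  M ^m zero  = 1m
  M ^m suc m = M *m (M ^m m)

  trace : Mat → Carrier
  trace M = sumF (λ i → M i i)

  IsInverse : Mat → Mat → Set ℓ
  IsInverse M N = ((M *m N) ≈m 1m) × ((N *m M) ≈m 1m)

  IsSubspaceOf : ∀ {t w} {T : Set t} (_≃_ : T → T → Set ℓ) (z : T)
                 (_⊕_ : T → T → T) (_⊙_ : Carrier → T → T)
                 (W : T → Set w) → Set (c ⊔ ℓ ⊔ t ⊔ w)
  IsSubspaceOf _≃_ z _⊕_ _⊙_ W =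
    (∀ {x y} → x ≃ y → W x → W y) × W z ×
    (∀ {x y} → W x → W y → W (x ⊕ y)) × (∀ a {x} → W x → W (a ⊙ x))

  IsSubspaceV : (Vect → Set (c ⊔ ℓ)) → Set (c ⊔ ℓ)
  IsSubspaceV = IsSubspaceOf _≈v_ 0v _+v_ _·v_

  IsSubspaceM : (Mat → Set (c ⊔ ℓ)) → Set (c ⊔ ℓ)
  IsSubspaceM = IsSubspaceOf _≈m_ 0m _+m_ _·m_

  IsIrreducible : (Mat → Set (c ⊔ ℓ)) → Set (lsuc (c ⊔ ℓ))
  IsIrreducible S =
    (Σ Vect λ v → ¬ (v ≈v 0v)) ×
    ((W : Vect → Set (c ⊔ ℓ)) → IsSubspaceV W →
      (∀ M → S M → ∀ v → W v → W (M $ v)) →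
      (∀ v → W v → v ≈v 0v) ⊎ (∀ v → W v))

  GenEig : Mat → Carrier → Vect → Set ℓ
  GenEig g α v = Σ ℕ λ m → (((g -m (α ·m 1m)) ^m m) $ v) ≈v 0v

  -- P is the projection of V onto V_{g,α} along the sum of the other
  -- generalized eigenspaces, i.e. along the image of (g - α)^n
  IsGenEigProj : Mat → Carrier → Mat → Set (c ⊔ ℓ)
  IsGenEigProj g α P = ∀ u → GenEig g α (P $ u) ×
    (Σ Vect λ w → (((g -m (α ·m 1m)) ^m n) $ w) ≈v (u -v (P $ u)))

  OneDim : (Vect → Set ℓ) → Set (c ⊔ ℓ)
  OneDim S = Σ Vect λ v → S v × ¬ (v ≈v 0v) ×
    (∀ w → S w → Σ Carrier λ a → w ≈v (a ·v v))

mapMat : ∀ {c ℓ c' ℓ'} {R : CommutativeRing c ℓ} {R' : CommutativeRing c' ℓ'} {n : ℕ} →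
         (CommutativeRing.Carrier R' → CommutativeRing.Carrier R) →
         Lin.Mat R' n → Lin.Mat R n
mapMat ι M i j = ι (M i j)

-- finite groups, presented on Fin q with propositional equality
-- (every finite group of order q is isomorphic to one of these)

record FinGroup (q : ℕ) : Set where
  field
    _∙_ : Fin q → Fin q → Fin q
    e   : Fin q
    inv : Fin q → Fin q
    isGroup : IsGroup _≡_ _∙_ e inv

module _ {c ℓ : Level} (k : Field c ℓ) (n : ℕ) where
  open Field k
  open Lin commutativeRing n

  record IsSubgroupGL (G : Mat → Set (c ⊔ ℓ)) : Set (c ⊔ ℓ) where
    field
      resp : ∀ {M N} → M ≈m N → G M → G N
      one  : G 1m
      mul  : ∀ {M N} → G M → G N → G (M *m N)
      inv  : ∀ {M} → G M → Σ Mat λ N → IsInverse M N × G N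

  scalarsTimes : (Mat → Set (c ⊔ ℓ)) → Mat → Set (c ⊔ ℓ)
  scalarsTimes G M = Σ Carrier λ a → ¬ (a ≈ 0#) ×
    Σ Mat λ h → G h × (M ≈m (a ·m h))

  module _ (p : ℕ) (G : Mat → Set (c ⊔ ℓ)) where

    -- (B1) no non-trivial quotient of p-power order
    B1 : Set (c ⊔ ℓ)
    B1 = (m : ℕ) → 1 ≤ m → (H : FinGroup (p ^ m)) →
         (φ : (M : Mat) → G M → Fin (p ^ m)) →
         (∀ M x N y → M ≈m N → φ M x ≡ φ N y) →
         (∀ M x N y xy → φ (M *m N) xy ≡ FinGroup._∙_ H (φ M x) (φ N y)) →
         ¬ (∀ z → Σ Mat λ M → Σ (G M) λ x → φ M x ≡ z)

    -- (B2) V is absolutely irreducible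
    B2 : Set (lsuc (c ⊔ ℓ))
    B2 = (K : Field c ℓ) (ι : Carrier → Field.Carrier K) →
         RingMorphisms.IsRingHomomorphism
           (CommutativeRing.rawRing commutativeRing)
           (CommutativeRing.rawRing (Field.commutativeRing K)) ι →
         Lin.IsIrreducible (Field.commutativeRing K) n
           (λ N → Σ Mat λ M → G M ×
              Lin._≈m_ (Field.commutativeRing K) n N
                (mapMat {R = Field.commutativeRing K} {R' = commutativeRing} ι M))

    -- (B3) H^1(G, ad° V) = 0
    B3 : Set (c ⊔ ℓ)
    B3 = (cc : (M : Mat) → G M → Mat) →
         (∀ M x → trace (cc M x) ≈ 0#) →
         (∀ M x N y → M ≈m N → cc M x ≈m cc N y) →
         (∀ M x N y xy g' → IsInverse M g' →
            cc (M *m N) xy ≈m (cc M x +m ((M *m cc N y) *m g'))) →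
         Σ Mat λ X → trace X ≈ 0# ×
           (∀ M x g' → IsInverse M g' →
              cc M x ≈m (((M *m X) *m g') -m X))

    Stable : (Mat → Set (c ⊔ ℓ)) → Set (c ⊔ ℓ)
    Stable W = ∀ g g' → G g → IsInverse g g' → ∀ f → W f → W ((g *m f) *m g')

    IsIrredSubmodule : (Mat → Set (c ⊔ ℓ)) → Set (lsuc (c ⊔ ℓ))
    IsIrredSubmodule W = IsSubspaceM W × Stable W ×
      (Σ Mat λ f → W f × ¬ (f ≈m 0m)) ×
      ((U : Mat → Set (c ⊔ ℓ)) → IsSubspaceM U → Stable U →
         (∀ f → U f → W f) →
         (∀ f → U f → f ≈m 0m) ⊎ (∀ f → W f → U f))

    B4 : Set (lsuc (c ⊔ ℓ))
    B4 = (W : Mat → Set (c ⊔ ℓ)) → IsIrredSubmodule W →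
         Σ Mat λ g → G g × Σ Carrier λ α → Σ Mat λ f → W f ×
           OneDim (GenEig g α) ×
           Σ Mat λ P → IsGenEigProj g α P ×
             Σ Vect λ v → GenEig g α v × ¬ ((P $ (f $ v)) ≈v 0v)

    Big : Set (lsuc (c ⊔ ℓ))
    Big = B1 × B2 × B3 × B4

-- Every element of k^×G is a·h with a ∈ k^× and h ∈ G, and the four conditions are blind to the
-- scalar factor.  The key point is that scalars are invisible to homomorphisms into p-groups and to
-- 1-cocycles: since k is finite, every a ∈ k^× satisfies a^N = 1 for some N prime to p (a^i = a^j
-- for some i < j, and p-power roots of 1 are trivial because x ↦ x^p is additive).  A homomorphism
-- to a group of order p^m therefore kills a (the order of its image divides both N and p^m), and a
-- cocycle c satisfies N·c(a) = c(a^N) = 0, hence c(a) = 0.  So homomorphisms and cocycles on G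
-- extend to k^×G by c(a·h) := c(h), which handles (B1) and (B3); the G- and k^×G-stable subspaces
-- of V and of ad V coincide, which handles (B2) and the irreducible submodules in (B4); and the
-- generalized α-eigenspace of a·h is the generalized α/a-eigenspace of h.

module Submission where

open import Defs
open import Level using (_⊔_)
open import Data.Nat using (ℕ)
open import Function.Bundles using (_⇔_)
open import Data.Product.Function.NonDependent.Propositional using (_×-⇔_)
open import Data.Nat.Primality using (Prime)
open import Algebra.Bundles using (Monoid; CommutativeRing)
open import Algebra.Morphism.Structures using (module RingMorphisms)

module LeastWitness where

  open import Data.Nat using (ℕ; zero; suc; _<_)
  open import Data.Nat.Properties using (m<1+n⇒m<n∨m≡n; n<1+n)
  open import Data.Product using (Σ; _×_; _,_)
  open import Data.Sum using (_⊎_; inj₁; inj₂; [_,_])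
  open import Relation.Nullary using (¬_; yes; no; contradiction)
  open import Relation.Unary using (Pred; Decidable)
  open import Relation.Binary.PropositionalEquality using (refl)

  Least : ∀ {a} → Pred ℕ a → ℕ → Set a
  Least P d = P d × (∀ {i} → i < d → ¬ P i)

  least-witness : ∀ {a} {P : Pred ℕ a} → Decidable P → ∀ {D} → P D → Σ ℕ (Least P)
  least-witness {P = P} P? {D} PD with search (suc D)
    where
      search : ∀ n → (∀ {i} → i < n → ¬ P i) ⊎ Σ ℕ (Least P)
      search zero = inj₁ λ ()
      search (suc n) with search n
      ... | inj₂ least = inj₂ least
      ... | inj₁ none-below with P? n
      ...   | yes Pn = inj₂ (n , Pn , none-below)
      ...   | no ¬Pn = inj₁ λ i<1+n → [ none-below , (λ { refl → ¬Pn }) ] (m<1+n⇒m<n∨m≡n i<1+n)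
  ... | inj₁ none-below = contradiction PD (none-below (n<1+n D))
  ... | inj₂ least      = least

module PrimeArithmetic {p : ℕ} (p-prime : Prime p) where

  open import Data.Nat
  open import Data.Nat.Properties
  open import Data.Nat.Divisibility
  open import Data.Nat.Primality using (euclidsLemma; prime⇒irreducible; prime⇒nonTrivial)
  open import Data.Nat.Coprimality using (Coprime; coprime-divisor)
  open import Data.Nat.Combinatorics using (_C_; k![n∸k]!∣n!)
  open import Data.Nat.Combinatorics.Specification using (nCk≡n!/k![n-k]!)
  open import Data.Nat.DivMod using (m/n*n≡m)
  open import Data.Nat.Induction using (<-rec)
  open import Data.Product using (Σ; _×_; _,_)
  open import Data.Sum using (inj₁; inj₂)
  open import Relation.Nullary using (¬_; yes; no; contradiction)
  open import Relation.Binary.PropositionalEquality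

  1<p : 1 < p
  1<p = nonTrivial⇒n>1 p {{prime⇒nonTrivial p-prime}}

  p∤1 : ¬ p ∣ 1
  p∤1 p∣1 = nonTrivial⇒≢1 {{prime⇒nonTrivial p-prime}} (∣1⇒≡1 p∣1)

  p∤m! : ∀ {m} → m < p → ¬ p ∣ m !
  p∤m! {zero}  _     = p∤1
  p∤m! {suc m} 1+m<p p∣m! with euclidsLemma (suc m) (m !) p-prime p∣m!
  ... | inj₁ p∣1+m = <⇒≱ 1+m<p (∣⇒≤ p∣1+m)
  ... | inj₂ p∣m!  = p∤m! (<-trans (n<1+n m) 1+m<p) p∣m!

  p∣pCk : ∀ {k} → 0 < k → k < p → p ∣ p C k
  p∣pCk {k} 0<k k<p with euclidsLemma (p C k) (k ! * (p ∸ k) !) p-prime p∣product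
    where
      p∣product : p ∣ (p C k) * (k ! * (p ∸ k) !)
      p∣product = subst (p ∣_) (sym (begin
        (p C k) * (k ! * (p ∸ k) !)                  ≡⟨ cong (_* (k ! * (p ∸ k) !)) (nCk≡n!/k![n-k]! (<⇒≤ k<p)) ⟩
        (p ! / (k ! * (p ∸ k) !)) * (k ! * (p ∸ k) !) ≡⟨ m/n*n≡m (k![n∸k]!∣n! (<⇒≤ k<p)) ⟩
        p ! ∎)) (n∣n! (<-trans z<s 1<p))
        where
          open ≡-Reasoning
          instance _ = k !* (p ∸ k) !≢0
          n∣n! : ∀ {n} → 0 < n → n ∣ n !
          n∣n! {suc n} _ = ∣m⇒∣m*n (n !) ∣-refl
  ... | inj₁ p∣pCk = p∣pCk
  ... | inj₂ p∣k![p∸k]! with euclidsLemma (k !) ((p ∸ k) !) p-prime p∣k![p∸k]!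
  ...   | inj₁ p∣k!     = contradiction p∣k! (p∤m! k<p)
  ...   | inj₂ p∣[p∸k]! = contradiction p∣[p∸k]! (p∤m! (∸-monoʳ-< 0<k (<⇒≤ k<p)))

  p∤⇒coprime : ∀ {N} → ¬ p ∣ N → Coprime N p
  p∤⇒coprime p∤N (d∣N , d∣p) with prime⇒irreducible p-prime d∣p
  ... | inj₁ d≡1 = d≡1
  ... | inj₂ refl = contradiction d∣N p∤N

  ∣p^m∧∣N⇒≡1 : ∀ {N d} → ¬ p ∣ N → ∀ m → d ∣ p ^ m → d ∣ N → d ≡ 1
  ∣p^m∧∣N⇒≡1 p∤N zero    d∣1     d∣N = ∣1⇒≡1 d∣1
  ∣p^m∧∣N⇒≡1 p∤N (suc m) d∣p^1+m d∣N = ∣p^m∧∣N⇒≡1 p∤N m (coprime-divisor d⊥p d∣p^1+m) d∣N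
    where
      d⊥p : Coprime _ p
      d⊥p (e∣d , e∣p) = p∤⇒coprime p∤N (∣-trans e∣d d∣N , e∣p)

  PPartSplitting : ℕ → Set
  PPartSplitting D = Σ ℕ λ e → Σ ℕ λ N → ¬ p ∣ N × D ≡ p ^ e * N

  p-part-splitting : ∀ D → 0 < D → PPartSplitting D
  p-part-splitting = <-rec (λ D → 0 < D → PPartSplitting D) split
    where
      split : ∀ D → (∀ {D′} → D′ < D → 0 < D′ → PPartSplitting D′) → 0 < D → PPartSplitting D
      split D rec 0<D with p ∣? D
      ... | no p∤D = 0 , D , p∤D , sym (+-identityʳ D)
      ... | yes (divides q@(suc _) refl) with rec (m<m*n q p 1<p) z<s
      ...   | e , N , p∤N , q≡p^e*N = suc e , N , p∤N , (begin
        q * p           ≡⟨ cong (_* p) q≡p^e*N ⟩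
        p ^ e * N * p   ≡⟨ *-comm (p ^ e * N) p ⟩
        p * (p ^ e * N) ≡⟨ *-assoc p (p ^ e) N ⟨
        p ^ suc e * N   ∎)
        where open ≡-Reasoning

module Counting where

  open import Data.Nat using (ℕ; zero; suc; _+_)
  open import Data.Bool using (Bool; true; false; T; T?; _∧_; _∨_; not; if_then_else_)
  open import Data.Bool.Properties using (T-∧)
  open import Data.Fin using (Fin; zero; suc)
  open import Data.Fin.Properties using (any?; suc-injective) renaming (_≟_ to _≟ᶠ_)
  open import Data.Product using (∃; _×_; _,_)
  open import Data.Sum using (_⊎_; inj₁; inj₂)
  open import Function using (_∘_; Equivalence)
  open import Relation.Nullary using (¬_; does; yes; no; contradiction)
  open import Relation.Nullary.Decidable using (dec-true)
  open import Relation.Binary.PropositionalEquality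
  open import Data.Nat.Properties using (+-commutativeSemigroup)
  open import Algebra.Properties.CommutativeSemigroup +-commutativeSemigroup using (interchange)

  bit : Bool → ℕ
  bit b = if b then 1 else 0

  count : ∀ {Q} → (Fin Q → Bool) → ℕ
  count {zero}  f = 0
  count {suc Q} f = bit (f zero) + count (f ∘ suc)

  module _ {Q : ℕ} where

    infixl 7 _∩_
    infixl 6 _∖_

    _∩_ _∖_ : (Fin Q → Bool) → (Fin Q → Bool) → Fin Q → Bool
    (f ∩ g) z = f z ∧ g z
    (f ∖ g) z = f z ∧ not (g z)

    ∖-elim : ∀ {f g z} → T ((f ∖ g) z) → T (f z) × ¬ T (g z)
    ∖-elim {g = g} {z} z∈f∖g with Equivalence.to T-∧ z∈f∖g
    ... | z∈f , z∉g = z∈f , T-not⇒¬T (g z) z∉g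
      where
        T-not⇒¬T : ∀ b → T (not b) → ¬ T b
        T-not⇒¬T true  ()

    ∖-intro : ∀ {f g z} → T (f z) → ¬ T (g z) → T ((f ∖ g) z)
    ∖-intro {g = g} {z} z∈f z∉g = Equivalence.from T-∧ (z∈f , ¬T⇒T-not (g z) z∉g)
      where
        ¬T⇒T-not : ∀ b → ¬ T b → T (not b)
        ¬T⇒T-not true  ¬T = ¬T _
        ¬T⇒T-not false _  = _

  image : ∀ {d Q} → (Fin d → Fin Q) → Fin Q → Bool
  image o z = does (any? λ i → o i ≟ᶠ z)

  image-elim : ∀ {d Q} (o : Fin d → Fin Q) {z} → T (image o z) → ∃ λ i → o i ≡ z
  image-elim o {z} z∈o with any? (λ i → o i ≟ᶠ z)
  ... | yes o⁻¹z = o⁻¹z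

  image-intro : ∀ {d Q} (o : Fin d → Fin Q) i → T (image o (o i))
  image-intro o i = subst T (sym (dec-true (any? λ j → o j ≟ᶠ o i) (i , refl))) _

  count-cong : ∀ {Q} {f g : Fin Q → Bool} → (∀ z → f z ≡ g z) → count f ≡ count g
  count-cong {zero}  f≗g = refl
  count-cong {suc Q} f≗g = cong₂ _+_ (cong bit (f≗g zero)) (count-cong (f≗g ∘ suc))

  count-empty : ∀ {Q} {f : Fin Q → Bool} → (∀ z → ¬ T (f z)) → count f ≡ 0
  count-empty {zero}      f-empty = refl
  count-empty {suc Q} {f} f-empty with f zero | f-empty zero
  ... | false | _ = count-empty (f-empty ∘ suc)
  ... | true  | z∉f = contradiction _ z∉f

  count-full : ∀ Q → count {Q} (λ _ → true) ≡ Q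
  count-full zero    = refl
  count-full (suc Q) = cong suc (count-full Q)

  count-inhabited-or-empty : ∀ {Q} (f : Fin Q → Bool) → (∃ λ z → T (f z)) ⊎ count f ≡ 0
  count-inhabited-or-empty f with any? (λ z → T? (f z))
  ... | yes f-inhabited = inj₁ f-inhabited
  ... | no  f-empty     = inj₂ (count-empty λ z z∈f → f-empty (z , z∈f))

  count-split : ∀ {Q} (f g : Fin Q → Bool) → count f ≡ count (f ∩ g) + count (f ∖ g)
  count-split {zero}  f g = refl
  count-split {suc Q} f g = trans (cong₂ _+_ (bit-split (f zero) (g zero)) (count-split (f ∘ suc) (g ∘ suc)))
                                  (interchange (bit (f zero ∧ g zero)) (bit (f zero ∧ not (g zero))) _ _)
    where
      bit-split : ∀ a b → bit a ≡ bit (a ∧ b) + bit (a ∧ not b)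
      bit-split true  true  = refl
      bit-split true  false = refl
      bit-split false _     = refl

  count-∩-⊆ : ∀ {Q} (f g : Fin Q → Bool) → (∀ {z} → T (g z) → T (f z)) → count (f ∩ g) ≡ count g
  count-∩-⊆ f g g⊆f = count-cong λ z → ∩-⊆ (f z) (g z) g⊆f
    where
      ∩-⊆ : ∀ a b → (T b → T a) → (a ∧ b) ≡ b
      ∩-⊆ true  b     _   = refl
      ∩-⊆ false false _   = refl
      ∩-⊆ false true  b⇒a = contradiction (b⇒a _) λ ()

  count-disjoint-∨ : ∀ {Q} (f g : Fin Q → Bool) → (∀ z → T (f z) → ¬ T (g z)) →
                     count (λ z → f z ∨ g z) ≡ count f + count g
  count-disjoint-∨ {zero}  f g disjoint = refl
  count-disjoint-∨ {suc Q} f g disjoint =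
    trans (cong₂ _+_ (bit-∨ (f zero) (g zero) (disjoint zero)) (count-disjoint-∨ (f ∘ suc) (g ∘ suc) (disjoint ∘ suc)))
          (interchange (bit (f zero)) (bit (g zero)) _ _)
    where
      bit-∨ : ∀ a b → (T a → ¬ T b) → bit (a ∨ b) ≡ bit a + bit b
      bit-∨ true  true  a⇒¬b = contradiction _ (a⇒¬b _)
      bit-∨ true  false _    = refl
      bit-∨ false b     _    = refl

  count-singleton : ∀ {Q} (a : Fin Q) → count (λ z → does (a ≟ᶠ z)) ≡ 1
  count-singleton {suc Q} zero = cong suc (count-empty {Q} λ _ ())
  count-singleton (suc a)      = count-singleton a

  count-image : ∀ {d Q} (o : Fin d → Fin Q) → (∀ {i j} → o i ≡ o j → i ≡ j) → count (image o) ≡ d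
  count-image {zero} {Q} o o-injective = count-empty {Q} λ _ ()
  count-image {suc d}    o o-injective =
    trans (count-disjoint-∨ (λ z → does (o zero ≟ᶠ z)) (image (o ∘ suc)) disjoint)
          (cong₂ _+_ (count-singleton (o zero)) (count-image (o ∘ suc) (suc-injective ∘ o-injective)))
    where
      disjoint : ∀ z → T (does (o zero ≟ᶠ z)) → ¬ T (image (o ∘ suc) z)
      disjoint z o₀≡z z∈o₁₊ with o zero ≟ᶠ z | image-elim (o ∘ suc) z∈o₁₊
      ... | yes o₀≡z | i , o₁₊ᵢ≡z = contradiction (o-injective (trans o₁₊ᵢ≡z (sym o₀≡z))) λ ()

module FiniteGroupOrder {Q : ℕ} (H : FinGroup Q) where

  open import Level using (0ℓ)
  open import Data.Nat using (zero; suc; pred; _+_; _*_; _∸_; _≤_; _<_; z<s; >-nonZero)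
  open import Data.Nat.Properties
  open import Data.Nat.Divisibility using (_∣_; m%n≡0⇒n∣m; _∣0; ∣m∣n⇒∣m+n; ∣-refl)
  open import Data.Nat.DivMod using (_%_; _/_; m≡m%n+[m/n]*n; m%n<n)
  open import Data.Nat.Induction using (<-rec)
  open import Data.Bool using (Bool; true; T)
  open import Function using (_∘_)
  open import Data.Fin using (Fin; toℕ; fromℕ<)
  open import Data.Fin.Properties using (pigeonhole; toℕ<n; toℕ-fromℕ<)
    renaming (_≟_ to _≟ᶠ_; <-cmp to <ᶠ-cmp)
  open import Data.Product using (Σ; _×_; _,_; proj₁; proj₂)
  open import Data.Sum using (inj₁; inj₂)
  open import Relation.Nullary using (contradiction)
  open import Relation.Nullary.Decidable using (_×-dec_)
  open import Relation.Binary.Definitions using (tri<; tri≈; tri>)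
  open import Relation.Binary.PropositionalEquality
  open import Algebra.Bundles using (Group)
  open Counting
  open LeastWitness

  open FinGroup H
  open import Algebra.Structures using (module IsGroup)
  open IsGroup isGroup using (assoc; identityˡ; identityʳ)

  group : Group 0ℓ 0ℓ
  group = record { isGroup = isGroup }

  open import Algebra.Properties.Group group using (∙-cancelˡ; ∙-cancelʳ)
  open import Algebra.Properties.Monoid.Mult (Group.monoid group)
    using (×-homo-+; ×-assocˡ) renaming (_×_ to _·_)

  infix 30 _^_
  _^_ : Fin Q → ℕ → Fin Q
  y ^ m = m · y

  ^-+ : ∀ y a b → y ^ (a + b) ≡ y ^ a ∙ y ^ b
  ^-+ y = ×-homo-+ y

  e^m≡e : ∀ m → e ^ m ≡ e
  e^m≡e zero    = refl
  e^m≡e (suc m) = trans (identityˡ _) (e^m≡e m)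

  ^-*-≡e : ∀ {y d} → y ^ d ≡ e → ∀ m → y ^ (m * d) ≡ e
  ^-*-≡e {y} {d} y^d≡e m = begin
    y ^ (m * d)   ≡⟨ ×-assocˡ y m d ⟨
    (y ^ d) ^ m   ≡⟨ cong (_^ m) y^d≡e ⟩
    e ^ m         ≡⟨ e^m≡e m ⟩
    e             ∎
    where open ≡-Reasoning

  y^a≡y^b⇒y^[b∸a]≡e : ∀ {y a b} → a ≤ b → y ^ a ≡ y ^ b → y ^ (b ∸ a) ≡ e
  y^a≡y^b⇒y^[b∸a]≡e {y} {a} {b} a≤b y^a≡y^b = sym (∙-cancelˡ (y ^ a) e _ (begin
    y ^ a ∙ e           ≡⟨ identityʳ _ ⟩
    y ^ a               ≡⟨ y^a≡y^b ⟩
    y ^ b               ≡⟨ cong (y ^_) (m+[n∸m]≡n a≤b) ⟨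
    y ^ (a + (b ∸ a))   ≡⟨ ^-+ y a (b ∸ a) ⟩
    y ^ a ∙ y ^ (b ∸ a) ∎))
    where open ≡-Reasoning

  IsOrder : Fin Q → ℕ → Set
  IsOrder y = Least (λ i → 0 < i × y ^ i ≡ e)

  order : ∀ y → Σ ℕ (IsOrder y)
  order y with pigeonhole (n<1+n Q) (λ (i : Fin (suc Q)) → y ^ toℕ i)
  ... | i , j , i<j , y^i≡y^j =
    least-witness (λ m → 0 <? m ×-dec y ^ m ≟ᶠ e) (m<n⇒0<n∸m i<j , y^a≡y^b⇒y^[b∸a]≡e (<⇒≤ i<j) y^i≡y^j)

  module Order {y : Fin Q} {d : ℕ} (y-order : IsOrder y d) where

    0<d : 0 < d
    0<d = proj₁ (proj₁ y-order)

    y^d≡e : y ^ d ≡ e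
    y^d≡e = proj₂ (proj₁ y-order)

    y^r≡e⇒r≡0 : ∀ {r} → r < d → y ^ r ≡ e → r ≡ 0
    y^r≡e⇒r≡0 {zero}  _   _       = refl
    y^r≡e⇒r≡0 {suc r} r<d y^r≡e = contradiction (z<s , y^r≡e) (proj₂ y-order r<d)

    order∣ : ∀ {N} → y ^ N ≡ e → d ∣ N
    order∣ {N} y^N≡e = m%n≡0⇒n∣m N d (y^r≡e⇒r≡0 (m%n<n N d) (begin
      y ^ (N % d)                        ≡⟨ identityʳ _ ⟨
      y ^ (N % d) ∙ e                    ≡⟨ cong (y ^ (N % d) ∙_) (^-*-≡e y^d≡e (N / d)) ⟨
      y ^ (N % d) ∙ y ^ ((N / d) * d)    ≡⟨ ^-+ y (N % d) _ ⟨
      y ^ (N % d + (N / d) * d)          ≡⟨ cong (y ^_) (m≡m%n+[m/n]*n N d) ⟨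
      y ^ N                              ≡⟨ y^N≡e ⟩
      e                                  ∎))
      where
        open ≡-Reasoning
        instance _ = >-nonZero 0<d

    coset : Fin Q → Fin d → Fin Q
    coset x i = y ^ toℕ i ∙ x

    cosetᵇ : Fin Q → Fin Q → Bool
    cosetᵇ x = image (coset x)

    y^a≢y^b : ∀ {a b} → a < b → b < d → y ^ a ≢ y ^ b
    y^a≢y^b {a} {b} a<b b<d y^a≡y^b =
      proj₂ y-order (≤-<-trans (m∸n≤m b a) b<d) (m<n⇒0<n∸m a<b , y^a≡y^b⇒y^[b∸a]≡e (<⇒≤ a<b) y^a≡y^b)

    coset-injective : ∀ x {i j} → coset x i ≡ coset x j → i ≡ j
    coset-injective x {i} {j} eq with <ᶠ-cmp i j
    ... | tri< i<j _ _ = contradiction (∙-cancelʳ x _ _ eq) (y^a≢y^b i<j (toℕ<n j))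
    ... | tri≈ _ i≡j _ = i≡j
    ... | tri> _ _ j<i = contradiction (sym (∙-cancelʳ x _ _ eq)) (y^a≢y^b j<i (toℕ<n i))

    LeftClosed : (Fin Q → Bool) → Set
    LeftClosed f = ∀ z → T (f z) → T (f (y ∙ z))

    closed⇒y^m∙x∈ : ∀ {f x} → LeftClosed f → T (f x) → ∀ m → T (f (y ^ m ∙ x))
    closed⇒y^m∙x∈ {f} {x} f-closed x∈f zero    = subst (T ∘ f) (sym (identityˡ x)) x∈f
    closed⇒y^m∙x∈ {f} {x} f-closed x∈f (suc m) =
      subst (T ∘ f) (sym (assoc y (y ^ m) x)) (f-closed _ (closed⇒y^m∙x∈ f-closed x∈f m))

    coset-predecessor : ∀ x {m} → m < d → Σ (Fin d) λ j → y ∙ coset x j ≡ y ^ m ∙ x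
    coset-predecessor x {suc m} 1+m<d = j , (begin
      y ∙ (y ^ toℕ j ∙ x) ≡⟨ cong (λ t → y ∙ (y ^ t ∙ x)) (toℕ-fromℕ< m<d) ⟩
      y ∙ (y ^ m ∙ x)     ≡⟨ assoc y (y ^ m) x ⟨
      y ^ suc m ∙ x       ∎)
      where
        open ≡-Reasoning
        m<d : m < d
        m<d = <-trans (n<1+n m) 1+m<d
        j : Fin d
        j = fromℕ< m<d
    coset-predecessor x {zero} _ = j , (begin
      y ∙ (y ^ toℕ j ∙ x)    ≡⟨ cong (λ t → y ∙ (y ^ t ∙ x)) (toℕ-fromℕ< d-1<d) ⟩
      y ∙ (y ^ pred d ∙ x)   ≡⟨ assoc y (y ^ pred d) x ⟨
      y ^ suc (pred d) ∙ x   ≡⟨ cong (λ t → y ^ t ∙ x) (suc-pred d) ⟩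
      y ^ d ∙ x              ≡⟨ cong (_∙ x) y^d≡e ⟩
      y ^ zero ∙ x           ∎)
      where
        open ≡-Reasoning
        instance _ = >-nonZero 0<d
        d-1<d : pred d < d
        d-1<d = subst (pred d <_) (suc-pred d) (n<1+n (pred d))
        j : Fin d
        j = fromℕ< d-1<d

    y∙z∈coset⇒z∈coset : ∀ x {z} → T (cosetᵇ x (y ∙ z)) → T (cosetᵇ x z)
    y∙z∈coset⇒z∈coset x y∙z∈coset with image-elim (coset x) y∙z∈coset
    ... | i , y^i∙x≡y∙z with coset-predecessor x (toℕ<n i)
    ...   | j , y∙xⱼ≡y^i∙x =
      subst (T ∘ cosetᵇ x) (∙-cancelˡ y _ _ (trans y∙xⱼ≡y^i∙x y^i∙x≡y∙z)) (image-intro (coset x) j)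

    ∖coset-closed : ∀ {f} x → LeftClosed f → LeftClosed (f ∖ cosetᵇ x)
    ∖coset-closed {f} x f-closed z z∈f∖xᵧ with ∖-elim {f = f} {cosetᵇ x} {z} z∈f∖xᵧ
    ... | z∈f , z∉xᵧ = ∖-intro {f = f} {cosetᵇ x} {y ∙ z} (f-closed z z∈f) (z∉xᵧ ∘ y∙z∈coset⇒z∈coset x)

    count-remove-coset : ∀ {f x} → LeftClosed f → T (f x) → count f ≡ d + count (f ∖ cosetᵇ x)
    count-remove-coset {f} {x} f-closed x∈f = begin
      count f                                      ≡⟨ count-split f (cosetᵇ x) ⟩
      count (f ∩ cosetᵇ x) + count (f ∖ cosetᵇ x)  ≡⟨ cong (_+ count (f ∖ cosetᵇ x)) (count-∩-⊆ f (cosetᵇ x) coset⊆f) ⟩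
      count (cosetᵇ x) + count (f ∖ cosetᵇ x)      ≡⟨ cong (_+ count (f ∖ cosetᵇ x)) (count-image (coset x) (coset-injective x)) ⟩
      d + count (f ∖ cosetᵇ x)                     ∎
      where
        open ≡-Reasoning
        coset⊆f : ∀ {z} → T (cosetᵇ x z) → T (f z)
        coset⊆f z∈xᵧ with image-elim (coset x) z∈xᵧ
        ... | i , refl = closed⇒y^m∙x∈ f-closed x∈f (toℕ i)

    -- A left-closed set is a disjoint union of cosets ⟨y⟩x, each with d elements.
    order∣count-closed : ∀ {f} → LeftClosed f → d ∣ count f
    order∣count-closed f-closed = <-rec P step _ refl f-closed
      where
        P : ℕ → Set
        P n = ∀ {f} → count f ≡ n → LeftClosed f → d ∣ n
        step : ∀ n → (∀ {m} → m < n → P m) → P n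
        step n rec {f} refl f-closed with count-inhabited-or-empty f
        ... | inj₂ count≡0 = subst (d ∣_) (sym count≡0) (d ∣0)
        ... | inj₁ (x , x∈f) = subst (d ∣_) (sym count≡d+rest)
                                 (∣m∣n⇒∣m+n ∣-refl (rec rest<n refl (∖coset-closed x f-closed)))
          where
            count≡d+rest : count f ≡ d + count (f ∖ cosetᵇ x)
            count≡d+rest = count-remove-coset f-closed x∈f
            rest<n : count (f ∖ cosetᵇ x) < count f
            rest<n = subst (count (f ∖ cosetᵇ x) <_) (sym count≡d+rest) (m<n+m _ 0<d)

    order∣Q : d ∣ Q
    order∣Q = subst (d ∣_) (count-full Q) (order∣count-closed {λ _ → true} λ _ _ → _)

module PGroups {p : ℕ} (p-prime : Prime p) where

  open import Data.Nat as ℕ using ()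
  open import Data.Nat.Divisibility using (_∣_)
  open import Data.Product using (proj₁; proj₂)
  open import Relation.Nullary using (¬_)
  open import Relation.Binary.PropositionalEquality
  open import Algebra.Structures using (module IsGroup)
  open PrimeArithmetic p-prime using (∣p^m∧∣N⇒≡1)

  p∤N∧y^N≡e⇒y≡e : ∀ {m N} (H : FinGroup (p ℕ.^ m)) → ¬ p ∣ N → ∀ y →
                  FiniteGroupOrder._^_ H y N ≡ FinGroup.e H → y ≡ FinGroup.e H
  p∤N∧y^N≡e⇒y≡e {m} H p∤N y y^N≡e = begin
    y        ≡⟨ identityʳ y ⟨
    y ^ 1    ≡⟨ cong (y ^_) d≡1 ⟨
    y ^ d    ≡⟨ y^d≡e ⟩
    e        ∎
    where
      open ≡-Reasoning
      open FinGroup H using (e; isGroup)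
      open IsGroup isGroup using (identityʳ)
      open FiniteGroupOrder H using (_^_; order; module Order)
      d : ℕ
      d = proj₁ (order y)
      open Order (proj₂ (order y)) using (y^d≡e; order∣Q; order∣)
      d≡1 : d ≡ 1
      d≡1 = ∣p^m∧∣N⇒≡1 p∤N m order∣Q (order∣ y^N≡e)

module FieldProperties {c ℓ} (k : Field c ℓ) where

  open import Data.Nat using (zero; suc)
  open import Data.Product using (Σ; _×_; _,_)
  open import Relation.Nullary using (¬_)
  open Field k
  open import Relation.Binary.Reasoning.Setoid setoid
  open import Algebra.Properties.Ring ring using (x[y-z]≈xy-xz; x∙y⁻¹≈ε⇒x≈y)
  open import Algebra.Properties.Semiring.Exp semiring using (_^_)

  1≉0 : ¬ 1# ≈ 0#
  1≉0 1≈0 = 0≉1 (sym 1≈0)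

  x*y≈0⇒y≈0 : ∀ {x y} → ¬ x ≈ 0# → x * y ≈ 0# → y ≈ 0#
  x*y≈0⇒y≈0 {x} {y} x≉0 x*y≈0 with inverse x x≉0
  ... | x⁻¹ , x*x⁻¹≈1 = begin
    y              ≈⟨ *-identityˡ y ⟨
    1# * y         ≈⟨ *-congʳ x*x⁻¹≈1 ⟨
    (x * x⁻¹) * y  ≈⟨ *-congʳ (*-comm x x⁻¹) ⟩
    (x⁻¹ * x) * y  ≈⟨ *-assoc x⁻¹ x y ⟩
    x⁻¹ * (x * y)  ≈⟨ *-congˡ x*y≈0 ⟩
    x⁻¹ * 0#       ≈⟨ zeroʳ x⁻¹ ⟩
    0#             ∎

  x≉0∧y≉0⇒x*y≉0 : ∀ {x y} → ¬ x ≈ 0# → ¬ y ≈ 0# → ¬ x * y ≈ 0#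
  x≉0∧y≉0⇒x*y≉0 x≉0 y≉0 x*y≈0 = y≉0 (x*y≈0⇒y≈0 x≉0 x*y≈0)

  1^n≈1 : ∀ n → 1# ^ n ≈ 1#
  1^n≈1 zero    = refl
  1^n≈1 (suc n) = trans (*-identityˡ _) (1^n≈1 n)

  x≉0⇒x^n≉0 : ∀ {x} → ¬ x ≈ 0# → ∀ n → ¬ x ^ n ≈ 0#
  x≉0⇒x^n≉0 x≉0 zero    = 1≉0
  x≉0⇒x^n≉0 x≉0 (suc n) = x≉0∧y≉0⇒x*y≉0 x≉0 (x≉0⇒x^n≉0 x≉0 n)

  *-cancelˡ-≉0 : ∀ {x y z} → ¬ x ≈ 0# → x * y ≈ x * z → y ≈ z
  *-cancelˡ-≉0 {x} {y} {z} x≉0 x*y≈x*z = x∙y⁻¹≈ε⇒x≈y y z (x*y≈0⇒y≈0 x≉0 (begin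
    x * (y - z)    ≈⟨ x[y-z]≈xy-xz x y z ⟩
    x * y - x * z  ≈⟨ +-congʳ x*y≈x*z ⟩
    x * z - x * z  ≈⟨ -‿inverseʳ (x * z) ⟩
    0#             ∎))

  unit-inverse : ∀ {x} → ¬ x ≈ 0# → Σ Carrier λ y → x * y ≈ 1# × ¬ y ≈ 0#
  unit-inverse {x} x≉0 with inverse x x≉0
  ... | y , x*y≈1 = y , x*y≈1 , λ y≈0 → 1≉0 (begin
    1#      ≈⟨ x*y≈1 ⟨
    x * y   ≈⟨ *-congˡ y≈0 ⟩
    x * 0#  ≈⟨ zeroʳ x ⟩
    0#      ∎)

module MonoidSums {c ℓ} (M : Monoid c ℓ) where

  open import Data.Nat using (suc; _<_; z<s; s<s)
  open import Data.Fin using (toℕ; fromℕ; inject₁)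
  import Data.Fin as Fin
  open import Data.Fin.Properties using (toℕ-inject₁; toℕ<n)
  open import Data.Vec.Functional using (Vector; tail; init; last)
  open import Relation.Binary.PropositionalEquality as ≡ using ()
  open Monoid M
  open import Algebra.Properties.Monoid.Sum M using (sum; sum-init-last; sum-cong-≋; sum-replicate-zero)
  open import Relation.Binary.Reasoning.Setoid setoid

  sum-ends : ∀ {n} (t : Vector Carrier (suc n)) → 0 < n →
             (∀ i → 0 < toℕ i → toℕ i < n → t i ≈ ε) → sum t ≈ t Fin.zero ∙ t (fromℕ n)
  sum-ends {suc n} t _ middle≈ε = ∙-congˡ (begin
    sum (tail t)                  ≈⟨ sum-init-last (tail t) ⟩
    sum (init (tail t)) ∙ last t  ≈⟨ ∙-congʳ (trans (sum-cong-≋ init-tail≈ε) (sum-replicate-zero n)) ⟩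
    ε ∙ last t                    ≈⟨ identityˡ (last t) ⟩
    last t                        ∎)
    where
      init-tail≈ε : ∀ i → t (Fin.suc (inject₁ i)) ≈ ε
      init-tail≈ε i = middle≈ε _ z<s (s<s (≡.subst (_< n) (≡.sym (toℕ-inject₁ i)) (toℕ<n i)))

module FieldOfCharacteristic {c ℓ} (k : Field c ℓ) {p : ℕ} (k-char : HasChar k p) where

  open import Data.Nat as ℕ using (zero; suc; _<_; z<s)
  import Data.Nat.Properties as ℕ
  open import Data.Nat.Divisibility using (_∣_; divides)
  open import Data.Nat.Coprimality using (coprime-Bézout)
  open import Data.Nat.GCD using (module Bézout)
  open import Data.Nat.Combinatorics using (nCn≡1)
  open import Data.Fin as Fin using (toℕ; fromℕ)
  open import Data.Fin.Properties using (toℕ-fromℕ)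
  open import Data.Product using (proj₁; proj₂)
  open import Relation.Nullary using (¬_)
  open import Relation.Binary.PropositionalEquality as ≡ using (_≡_)
  open Field k
  open FieldProperties k using (1≉0)
  open PrimeArithmetic (proj₁ k-char) using (1<p; p∣pCk; p∤⇒coprime)
  open MonoidSums +-monoid using (sum-ends)
  open import Relation.Binary.Reasoning.Setoid setoid
  open import Algebra.Properties.Semiring.Exp semiring using (_^_)
  open import Algebra.Properties.Semiring.Mult semiring using (×-congʳ; ×-assoc-*; ×1-homo-*) renaming (_×_ to _·_)
  open import Algebra.Properties.Semiring.Sum semiring using (sum)
  open import Algebra.Properties.CommutativeSemiring.Binomial commutativeSemiring using (binomialTerm; theorem)

  ℕ→k≈n·1 : ∀ n → ℕ→k k n ≈ n · 1#
  ℕ→k≈n·1 zero    = refl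
  ℕ→k≈n·1 (suc n) = +-congˡ (ℕ→k≈n·1 n)

  p·1≈0 : p · 1# ≈ 0#
  p·1≈0 = trans (sym (ℕ→k≈n·1 p)) (proj₂ k-char)

  n·x≈[n·1]*x : ∀ n x → n · x ≈ (n · 1#) * x
  n·x≈[n·1]*x n x = trans (×-congʳ n (sym (*-identityˡ x))) (sym (×-assoc-* n 1# x))

  p∣n⇒n·x≈0 : ∀ {n} x → p ∣ n → n · x ≈ 0#
  p∣n⇒n·x≈0 x (divides q ≡.refl) = begin
    (q ℕ.* p) · x                ≈⟨ n·x≈[n·1]*x (q ℕ.* p) x ⟩
    ((q ℕ.* p) · 1#) * x         ≈⟨ *-congʳ (×1-homo-* q p) ⟩
    ((q · 1#) * (p · 1#)) * x    ≈⟨ *-congʳ (*-congˡ p·1≈0) ⟩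
    ((q · 1#) * 0#) * x          ≈⟨ *-congʳ (zeroʳ _) ⟩
    0# * x                       ≈⟨ zeroˡ x ⟩
    0#                           ∎

  1+uv≡wz⇒1≈0 : ∀ u v w z → v · 1# ≈ 0# → z · 1# ≈ 0# → suc (u ℕ.* v) ≡ w ℕ.* z → 1# ≈ 0#
  1+uv≡wz⇒1≈0 u v w z v·1≈0 z·1≈0 1+uv≡wz = begin
    1#                              ≈⟨ +-identityʳ 1# ⟨
    1# + 0#                         ≈⟨ +-congˡ (zeroʳ (u · 1#)) ⟨
    1# + (u · 1#) * 0#              ≈⟨ +-congˡ (*-congˡ v·1≈0) ⟨
    1# + (u · 1#) * (v · 1#)        ≈⟨ +-congˡ (×1-homo-* u v) ⟨
    suc (u ℕ.* v) · 1#              ≡⟨ ≡.cong (_· 1#) 1+uv≡wz ⟩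
    (w ℕ.* z) · 1#                  ≈⟨ ×1-homo-* w z ⟩
    (w · 1#) * (z · 1#)             ≈⟨ *-congˡ z·1≈0 ⟩
    (w · 1#) * 0#                   ≈⟨ zeroʳ _ ⟩
    0#                              ∎

  p∤n⇒n·1≉0 : ∀ {n} → ¬ p ∣ n → ¬ n · 1# ≈ 0#
  p∤n⇒n·1≉0 {n} p∤n n·1≈0 with coprime-Bézout (p∤⇒coprime p∤n)
  ... | Bézout.+- u v 1+vp≡un = 1≉0 (1+uv≡wz⇒1≈0 v p u n p·1≈0 n·1≈0 1+vp≡un)
  ... | Bézout.-+ u v 1+un≡vp = 1≉0 (1+uv≡wz⇒1≈0 u n v p n·1≈0 p·1≈0 1+un≡vp)

  freshman's-dream : ∀ x y → (x + y) ^ p ≈ y ^ p + x ^ p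
  freshman's-dream x y = begin
    (x + y) ^ p                                                 ≈⟨ theorem p x y ⟩
    sum (binomialTerm x y p)                                    ≈⟨ sum-ends _ (ℕ.<-trans z<s 1<p) middle≈0 ⟩
    binomialTerm x y p Fin.zero + binomialTerm x y p (fromℕ p)  ≈⟨ +-cong first≈y^p last≈x^p ⟩
    y ^ p + x ^ p                                               ∎
    where
      middle≈0 : ∀ i → 0 < toℕ i → toℕ i < p → binomialTerm x y p i ≈ 0#
      middle≈0 i 0<i i<p = p∣n⇒n·x≈0 _ (p∣pCk 0<i i<p)
      first≈y^p : binomialTerm x y p Fin.zero ≈ y ^ p
      first≈y^p = trans (+-identityʳ _) (*-identityˡ _)
      last≈x^p : binomialTerm x y p (fromℕ p) ≈ x ^ p
      last≈x^p rewrite toℕ-fromℕ p | nCn≡1 p | ℕ.n∸n≡0 p = trans (+-identityʳ _) (*-identityʳ _)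

module FiniteFieldOfCharacteristic {c ℓ} (k : Field c ℓ) (k-finite : IsFinite k)
                                   {p : ℕ} (k-char : HasChar k p) where

  open import Data.Nat as ℕ using (zero; suc)
  import Data.Nat.Properties as ℕ
  open import Data.Nat.Divisibility using (_∣_)
  open import Data.Fin using (Fin; toℕ)
  open import Data.Fin.Properties using (pigeonhole) renaming (_≟_ to _≟ᶠ_)
  open import Data.Product using (Σ; _×_; _,_; proj₁; proj₂)
  open import Relation.Nullary using (¬_; Dec; yes; no; contradiction; map′)
  open import Relation.Binary.PropositionalEquality as ≡ using (_≡_)
  open import Function using (Inverse)
  open Field k
  open FieldProperties k
  open FieldOfCharacteristic k k-char using (freshman's-dream)
  open PrimeArithmetic (proj₁ k-char) using (p-part-splitting)
  open import Relation.Binary.Reasoning.Setoid setoid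
  open import Algebra.Properties.Semiring.Exp semiring using (_^_; ^-homo-*; ^-assocʳ; ^-congˡ)
  open import Algebra.Properties.Ring ring using (+-identityˡ-unique)

  private
    q : ℕ
    q = proj₁ k-finite

    open Inverse (proj₂ k-finite) using (to; to-cong; from-cong; inverseʳ)

    to-injective : ∀ {x y} → to x ≡ to y → x ≈ y
    to-injective eq = trans (sym (inverseʳ ≡.refl)) (trans (from-cong eq) (inverseʳ ≡.refl))

  _≟_ : ∀ x y → Dec (x ≈ y)
  x ≟ y = map′ to-injective to-cong (to x ≟ᶠ to y)

  x^p≈1⇒x≈1 : ∀ {x} → x ^ p ≈ 1# → x ≈ 1#
  x^p≈1⇒x≈1 {x} x^p≈1 = begin
    x              ≈⟨ x≈[x-1]+1 ⟨
    (x - 1#) + 1#  ≈⟨ +-congʳ [x-1]≈0 ⟩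
    0# + 1#        ≈⟨ +-identityˡ 1# ⟩
    1#             ∎
    where
      x≈[x-1]+1 : (x - 1#) + 1# ≈ x
      x≈[x-1]+1 = trans (+-assoc x (- 1#) 1#) (trans (+-congˡ (-‿inverseˡ 1#)) (+-identityʳ x))
      [x-1]^p≈0 : (x - 1#) ^ p ≈ 0#
      [x-1]^p≈0 = +-identityˡ-unique _ 1# (begin
        (x - 1#) ^ p + 1#       ≈⟨ +-congˡ (1^n≈1 p) ⟨
        (x - 1#) ^ p + 1# ^ p   ≈⟨ freshman's-dream 1# (x - 1#) ⟨
        (1# + (x - 1#)) ^ p     ≈⟨ ^-congˡ p (trans (+-comm 1# (x - 1#)) x≈[x-1]+1) ⟩
        x ^ p                   ≈⟨ x^p≈1 ⟩
        1#                      ∎)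
      [x-1]≈0 : x - 1# ≈ 0#
      [x-1]≈0 with (x - 1#) ≟ 0#
      ... | yes x-1≈0 = x-1≈0
      ... | no  x-1≉0 = contradiction [x-1]^p≈0 (x≉0⇒x^n≉0 x-1≉0 p)

  x^p^e≈1⇒x≈1 : ∀ e {x} → x ^ (p ℕ.^ e) ≈ 1# → x ≈ 1#
  x^p^e≈1⇒x≈1 zero    x^1≈1 = trans (sym (*-identityʳ _)) x^1≈1
  x^p^e≈1⇒x≈1 (suc e) {x} x^p^[1+e]≈1 =
    x^p≈1⇒x≈1 (x^p^e≈1⇒x≈1 e (trans (^-assocʳ x p (p ℕ.^ e)) x^p^[1+e]≈1))

  -- By pigeonhole x^i ≈ x^j with i < j; write j - i = p^e N with p ∤ N and take p^e-th roots.
  x≉0⇒∃[N]p∤N∧x^N≈1 : ∀ {x} → ¬ x ≈ 0# → Σ ℕ λ N → ¬ p ∣ N × x ^ N ≈ 1#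
  x≉0⇒∃[N]p∤N∧x^N≈1 {x} x≉0 with pigeonhole (ℕ.n<1+n q) (λ (i : Fin (suc q)) → to (x ^ toℕ i))
  ... | i , j , i<j , to-x^i≡to-x^j with p-part-splitting (toℕ j ℕ.∸ toℕ i) (ℕ.m<n⇒0<n∸m i<j)
  ...   | e , N , p∤N , j-i≡p^e*N = N , p∤N , x^p^e≈1⇒x≈1 e (begin
    (x ^ N) ^ (p ℕ.^ e)        ≈⟨ ^-assocʳ x N (p ℕ.^ e) ⟩
    x ^ (N ℕ.* p ℕ.^ e)        ≡⟨ ≡.cong (x ^_) (≡.trans (ℕ.*-comm N (p ℕ.^ e)) (≡.sym j-i≡p^e*N)) ⟩
    x ^ (toℕ j ℕ.∸ toℕ i)      ≈⟨ x^[j-i]≈1 ⟩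
    1#                         ∎)
    where
      x^[j-i]≈1 : x ^ (toℕ j ℕ.∸ toℕ i) ≈ 1#
      x^[j-i]≈1 = sym (*-cancelˡ-≉0 (x≉0⇒x^n≉0 x≉0 (toℕ i)) (begin
        x ^ toℕ i * 1#                          ≈⟨ *-identityʳ _ ⟩
        x ^ toℕ i                               ≈⟨ to-injective to-x^i≡to-x^j ⟩
        x ^ toℕ j                               ≡⟨ ≡.cong (x ^_) (ℕ.m+[n∸m]≡n (ℕ.<⇒≤ i<j)) ⟨
        x ^ (toℕ i ℕ.+ (toℕ j ℕ.∸ toℕ i))       ≈⟨ ^-homo-* x (toℕ i) _ ⟩
        x ^ toℕ i * x ^ (toℕ j ℕ.∸ toℕ i)       ∎))

module Matrices {c ℓ} (R : CommutativeRing c ℓ) (n : ℕ) where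

  open import Data.Nat using (zero; suc)
  open import Data.Fin as Fin using (Fin)
  open import Data.Fin.Properties using (punchInᵢ≢i)
  open import Data.Product using (_,_)
  open import Relation.Nullary using (yes; no; contradiction)
  open import Relation.Binary.Bundles using (Setoid)
  import Relation.Binary.Reasoning.Setoid
  open import Relation.Binary.PropositionalEquality as ≡ using (_≡_; _≢_)
  open import Function using (_∘_)
  open CommutativeRing R
  open Lin R n
  open import Algebra.Properties.Semiring.Exp semiring using (_^_)
  open import Algebra.Properties.CommutativeSemigroup *-commutativeSemigroup using (x∙yz≈y∙xz)
  open import Algebra.Properties.Semiring.Sum semiring
    using (sum; sum-cong-≋; sum-cong-≗; ∑-comm; *-distribˡ-sum; *-distribʳ-sum; sum-remove; sum-replicate-zero)

  sumF≡sum : ∀ {m} (f : Fin m → Carrier) → sumF f ≡ sum f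
  sumF≡sum {zero}  f = ≡.refl
  sumF≡sum {suc m} f = ≡.cong (f Fin.zero +_) (sumF≡sum (f ∘ Fin.suc))

  sumF-cong : ∀ {m} {f g : Fin m → Carrier} → (∀ i → f i ≈ g i) → sumF f ≈ sumF g
  sumF-cong {f = f} {g} f≈g rewrite sumF≡sum f | sumF≡sum g = sum-cong-≋ f≈g

  *-distribˡ-sumF : ∀ {m} a (f : Fin m → Carrier) → a * sumF f ≈ sumF (λ i → a * f i)
  *-distribˡ-sumF a f rewrite sumF≡sum f | sumF≡sum (λ i → a * f i) = *-distribˡ-sum a f

  *-distribʳ-sumF : ∀ {m} a (f : Fin m → Carrier) → sumF f * a ≈ sumF (λ i → f i * a)
  *-distribʳ-sumF a f rewrite sumF≡sum f | sumF≡sum (λ i → f i * a) = *-distribʳ-sum a f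

  sumF-comm : ∀ {m m′} (f : Fin m → Fin m′ → Carrier) →
              sumF (λ i → sumF (f i)) ≈ sumF (λ j → sumF (λ i → f i j))
  sumF-comm f = begin
    sumF (λ i → sumF (f i))
      ≡⟨ ≡.trans (sumF≡sum (λ i → sumF (f i))) (sum-cong-≗ (sumF≡sum ∘ f)) ⟩
    sum (λ i → sum (f i))
      ≈⟨ ∑-comm f ⟩
    sum (λ j → sum (λ i → f i j))
      ≡⟨ ≡.trans (sumF≡sum (λ j → sumF (λ i → f i j))) (sum-cong-≗ λ j → sumF≡sum (λ i → f i j)) ⟨
    sumF (λ j → sumF (λ i → f i j))
      ∎
    where open import Relation.Binary.Reasoning.Setoid setoid

  sumF-supported : ∀ {m} (f : Fin m → Carrier) i → (∀ j → j ≢ i → f j ≈ 0#) → sumF f ≈ f i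
  sumF-supported {suc m} f i f-supported = begin
    sumF f                                ≡⟨ sumF≡sum f ⟩
    sum f                                 ≈⟨ sum-remove f ⟩
    f i + sum (f ∘ Fin.punchIn i)         ≈⟨ +-congˡ (sum-cong-≋ λ j → f-supported _ (punchInᵢ≢i i j)) ⟩
    f i + sum {m} (λ _ → 0#)              ≈⟨ +-congˡ (sum-replicate-zero m) ⟩
    f i + 0#                              ≈⟨ +-identityʳ (f i) ⟩
    f i                                   ∎
    where open import Relation.Binary.Reasoning.Setoid setoid

  1m-diag : ∀ i → 1m i i ≈ 1#
  1m-diag i with i Fin.≟ i
  ... | yes _ = refl
  ... | no i≢i = contradiction ≡.refl i≢i

  1m-off : ∀ {i j} → i ≢ j → 1m i j ≈ 0#
  1m-off {i} {j} i≢j with i Fin.≟ j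
  ... | yes i≡j = contradiction i≡j i≢j
  ... | no _    = refl

  ≈m-setoid : Setoid c ℓ
  ≈m-setoid = record
    { Carrier       = Mat
    ; _≈_           = _≈m_
    ; isEquivalence = record
      { refl  = λ i j → refl
      ; sym   = λ M≈N i j → sym (M≈N i j)
      ; trans = λ M≈N N≈P i j → trans (M≈N i j) (N≈P i j)
      }
    }

  module ≈m = Setoid ≈m-setoid
  module ≈m-Reasoning = Relation.Binary.Reasoning.Setoid ≈m-setoid

  *m-cong : ∀ {M M′ N N′} → M ≈m M′ → N ≈m N′ → (M *m N) ≈m (M′ *m N′)
  *m-cong M≈M′ N≈N′ i j = sumF-cong λ l → *-cong (M≈M′ i l) (N≈N′ l j)

  *m-assoc : ∀ M N P → ((M *m N) *m P) ≈m (M *m (N *m P))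
  *m-assoc M N P i j = begin
    sumF (λ l → sumF (λ t → M i t * N t l) * P l j)    ≈⟨ sumF-cong (λ l → *-distribʳ-sumF (P l j) (λ t → M i t * N t l)) ⟩
    sumF (λ l → sumF (λ t → M i t * N t l * P l j))    ≈⟨ sumF-comm (λ l t → M i t * N t l * P l j) ⟩
    sumF (λ t → sumF (λ l → M i t * N t l * P l j))    ≈⟨ sumF-cong (λ t → sumF-cong λ l → *-assoc (M i t) (N t l) (P l j)) ⟩
    sumF (λ t → sumF (λ l → M i t * (N t l * P l j)))  ≈⟨ sumF-cong (λ t → *-distribˡ-sumF (M i t) (λ l → N t l * P l j)) ⟨
    sumF (λ t → M i t * sumF (λ l → N t l * P l j))    ∎
    where open import Relation.Binary.Reasoning.Setoid setoid

  *m-identityˡ : ∀ M → (1m *m M) ≈m M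
  *m-identityˡ M i j = trans (sumF-supported _ i λ l l≢i → trans (*-congʳ (1m-off (l≢i ∘ ≡.sym))) (zeroˡ _))
                             (trans (*-congʳ (1m-diag i)) (*-identityˡ _))

  *m-identityʳ : ∀ M → (M *m 1m) ≈m M
  *m-identityʳ M i j = trans (sumF-supported _ j λ l l≢j → trans (*-congˡ (1m-off l≢j)) (zeroʳ _))
                             (trans (*-congˡ (1m-diag j)) (*-identityʳ _))

  ·m-cong : ∀ {a b M N} → a ≈ b → M ≈m N → (a ·m M) ≈m (b ·m N)
  ·m-cong a≈b M≈N i j = *-cong a≈b (M≈N i j)

  ·m-·m : ∀ a b M → (a ·m (b ·m M)) ≈m ((a * b) ·m M)
  ·m-·m a b M i j = sym (*-assoc a b (M i j))

  ·m-identity : ∀ M → (1# ·m M) ≈m M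
  ·m-identity M i j = *-identityˡ (M i j)

  ·m-*m : ∀ a M N → ((a ·m M) *m N) ≈m (a ·m (M *m N))
  ·m-*m a M N i j = trans (sumF-cong λ l → *-assoc a (M i l) (N l j)) (sym (*-distribˡ-sumF a λ l → M i l * N l j))

  *m-·m : ∀ a M N → (M *m (a ·m N)) ≈m (a ·m (M *m N))
  *m-·m a M N i j = trans (sumF-cong λ l → x∙yz≈y∙xz (M i l) a (N l j)) (sym (*-distribˡ-sumF a λ l → M i l * N l j))

  ·m-*m-·m : ∀ a b M N → ((a ·m M) *m (b ·m N)) ≈m ((a * b) ·m (M *m N))
  ·m-*m-·m a b M N = ≈m.trans (·m-*m a M _) (≈m.trans (·m-cong refl (*m-·m b M N)) (·m-·m a b _))

  *m-factors : ∀ {M N a b g h} → M ≈m (a ·m g) → N ≈m (b ·m h) → (M *m N) ≈m ((a * b) ·m (g *m h))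
  *m-factors M≈ag N≈bh = ≈m.trans (*m-cong M≈ag N≈bh) (·m-*m-·m _ _ _ _)

  scalar-*m : ∀ a M → ((a ·m 1m) *m M) ≈m (a ·m M)
  scalar-*m a M = ≈m.trans (·m-*m a 1m M) (·m-cong refl (*m-identityˡ M))

  $-cong : ∀ {M N u v} → M ≈m N → u ≈v v → (M $ u) ≈v (N $ v)
  $-cong M≈N u≈v i = sumF-cong λ j → *-cong (M≈N i j) (u≈v j)

  ·m-$ : ∀ a M v → ((a ·m M) $ v) ≈v (a ·v (M $ v))
  ·m-$ a M v i = trans (sumF-cong λ j → *-assoc a (M i j) (v j)) (sym (*-distribˡ-sumF a λ j → M i j * v j))

  $-·v : ∀ a M v → (M $ (a ·v v)) ≈v (a ·v (M $ v))
  $-·v a M v i = trans (sumF-cong λ j → x∙yz≈y∙xz (M i j) a (v j)) (sym (*-distribˡ-sumF a λ j → M i j * v j))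

  ^m-cong : ∀ {M N} → M ≈m N → ∀ j → (M ^m j) ≈m (N ^m j)
  ^m-cong M≈N zero    = ≈m.refl
  ^m-cong M≈N (suc j) = *m-cong M≈N (^m-cong M≈N j)

  ·m-^m : ∀ a M j → ((a ·m M) ^m j) ≈m ((a ^ j) ·m (M ^m j))
  ·m-^m a M zero    = ≈m.sym (·m-identity 1m)
  ·m-^m a M (suc j) = begin
    (a ·m M) *m ((a ·m M) ^m j)        ≈⟨ *m-cong ≈m.refl (·m-^m a M j) ⟩
    (a ·m M) *m ((a ^ j) ·m (M ^m j))  ≈⟨ ·m-*m a M _ ⟩
    a ·m (M *m ((a ^ j) ·m (M ^m j)))  ≈⟨ ·m-cong refl (*m-·m (a ^ j) M (M ^m j)) ⟩
    a ·m ((a ^ j) ·m (M ^m suc j))     ≈⟨ ·m-·m a (a ^ j) _ ⟩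
    (a ^ suc j) ·m (M ^m suc j)        ∎
    where open ≈m-Reasoning

  1m-^m : ∀ j → (1m ^m j) ≈m 1m
  1m-^m zero    = ≈m.refl
  1m-^m (suc j) = ≈m.trans (*m-identityˡ _) (1m-^m j)

  scalar-^m : ∀ a j → ((a ·m 1m) ^m j) ≈m ((a ^ j) ·m 1m)
  scalar-^m a j = ≈m.trans (·m-^m a 1m j) (·m-cong refl (1m-^m j))

  scalar-^m-≈1 : ∀ {a N} → a ^ N ≈ 1# → ((a ·m 1m) ^m N) ≈m 1m
  scalar-^m-≈1 {a} {N} a^N≈1 = ≈m.trans (scalar-^m a N) (≈m.trans (·m-cong a^N≈1 ≈m.refl) (·m-identity 1m))

  1m-inverse : IsInverse 1m 1m
  1m-inverse = *m-identityˡ 1m , *m-identityˡ 1m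

  IsInverse-respˡ : ∀ {M M′ N} → M ≈m M′ → IsInverse M N → IsInverse M′ N
  IsInverse-respˡ M≈M′ (M*N≈1 , N*M≈1) =
    ≈m.trans (*m-cong (≈m.sym M≈M′) ≈m.refl) M*N≈1 , ≈m.trans (*m-cong ≈m.refl (≈m.sym M≈M′)) N*M≈1

  inverse-unique : ∀ {M N N′} → IsInverse M N → IsInverse M N′ → N ≈m N′
  inverse-unique {M} {N} {N′} (_ , N*M≈1) (M*N′≈1 , _) = begin
    N                 ≈⟨ *m-identityʳ N ⟨
    N *m 1m           ≈⟨ *m-cong ≈m.refl M*N′≈1 ⟨
    N *m (M *m N′)    ≈⟨ *m-assoc N M N′ ⟨
    (N *m M) *m N′    ≈⟨ *m-cong N*M≈1 ≈m.refl ⟩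
    1m *m N′          ≈⟨ *m-identityˡ N′ ⟩
    N′                ∎
    where open ≈m-Reasoning

  ·m-inverse : ∀ {M N a b} → IsInverse M N → a * b ≈ 1# → IsInverse (a ·m M) (b ·m N)
  ·m-inverse {M} {N} {a} {b} (M*N≈1 , N*M≈1) a*b≈1 = scaled a b M*N≈1 a*b≈1 , scaled b a N*M≈1 (trans (*-comm b a) a*b≈1)
    where
      scaled : ∀ x y {A B} → (A *m B) ≈m 1m → x * y ≈ 1# → ((x ·m A) *m (y ·m B)) ≈m 1m
      scaled x y {A} {B} A*B≈1 x*y≈1 = begin
        (x ·m A) *m (y ·m B)   ≈⟨ ·m-*m x A _ ⟩
        x ·m (A *m (y ·m B))   ≈⟨ ·m-cong refl (*m-·m y A B) ⟩
        x ·m (y ·m (A *m B))   ≈⟨ ·m-·m x y _ ⟩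
        (x * y) ·m (A *m B)    ≈⟨ ·m-cong x*y≈1 A*B≈1 ⟩
        1# ·m 1m               ≈⟨ ·m-identity 1m ⟩
        1m                     ∎
        where open ≈m-Reasoning

  conjugate-·m : ∀ {g g⁻¹ h h⁻¹ a b} F → g ≈m (a ·m h) → a * b ≈ 1# → IsInverse g g⁻¹ → IsInverse h h⁻¹ →
                 ((g *m F) *m g⁻¹) ≈m ((h *m F) *m h⁻¹)
  conjugate-·m {g} {g⁻¹} {h} {h⁻¹} {a} {b} F g≈ah a*b≈1 g⁻¹-inv h⁻¹-inv = begin
    (g *m F) *m g⁻¹                     ≈⟨ *m-cong (*m-cong g≈ah ≈m.refl) g⁻¹≈bh⁻¹ ⟩
    ((a ·m h) *m F) *m (b ·m h⁻¹)       ≈⟨ *m-cong (·m-*m a h F) ≈m.refl ⟩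
    (a ·m (h *m F)) *m (b ·m h⁻¹)       ≈⟨ ·m-*m a _ _ ⟩
    a ·m ((h *m F) *m (b ·m h⁻¹))       ≈⟨ ·m-cong refl (*m-·m b _ h⁻¹) ⟩
    a ·m (b ·m ((h *m F) *m h⁻¹))       ≈⟨ ·m-·m a b _ ⟩
    (a * b) ·m ((h *m F) *m h⁻¹)        ≈⟨ ·m-cong a*b≈1 ≈m.refl ⟩
    1# ·m ((h *m F) *m h⁻¹)             ≈⟨ ·m-identity _ ⟩
    (h *m F) *m h⁻¹                     ∎
    where
      open ≈m-Reasoning
      g⁻¹≈bh⁻¹ : g⁻¹ ≈m (b ·m h⁻¹)
      g⁻¹≈bh⁻¹ = inverse-unique g⁻¹-inv (IsInverse-respˡ (≈m.sym g≈ah) (·m-inverse h⁻¹-inv a*b≈1))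

  scalar-conjugate : ∀ {a b s⁻¹} F → a * b ≈ 1# → IsInverse (a ·m 1m) s⁻¹ → (((a ·m 1m) *m F) *m s⁻¹) ≈m F
  scalar-conjugate F a*b≈1 s⁻¹-inv = ≈m.trans (conjugate-·m F ≈m.refl a*b≈1 s⁻¹-inv 1m-inverse)
                                             (≈m.trans (*m-identityʳ (1m *m F)) (*m-identityˡ F))

module ScaledEigenspaces {c ℓ} (k : Field c ℓ) (n : ℕ) where

  open import Data.Nat using (ℕ)
  open import Data.Product using (_,_)
  open import Relation.Nullary using (¬_)
  open Field k
  open Lin commutativeRing n
  open Matrices commutativeRing n
  open FieldProperties k
  open import Algebra.Properties.Semiring.Exp semiring using (_^_)
  open import Algebra.Properties.Ring ring using (-‿distribʳ-*)

  module _ {g h a b} (a≉0 : ¬ a ≈ 0#) (g≈ah : g ≈m (a ·m h)) (a*b≈1 : a * b ≈ 1#) (α : Carrier) where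

    private
      g-α h-bα : Mat
      g-α  = g -m (α ·m 1m)
      h-bα = h -m ((b * α) ·m 1m)

    g-α≈a[h-bα] : g-α ≈m (a ·m h-bα)
    g-α≈a[h-bα] i j = sym (begin
      a * (h i j - (b * α) * 1m i j)        ≈⟨ distribˡ a (h i j) _ ⟩
      a * h i j + a * - ((b * α) * 1m i j)  ≈⟨ +-cong (sym (g≈ah i j)) (sym (-‿distribʳ-* a _)) ⟩
      g i j - a * ((b * α) * 1m i j)        ≈⟨ +-congˡ (-‿cong (begin
          a * ((b * α) * 1m i j)    ≈⟨ *-assoc a (b * α) _ ⟨
          (a * (b * α)) * 1m i j    ≈⟨ *-congʳ (*-assoc a b α) ⟨
          ((a * b) * α) * 1m i j    ≈⟨ *-congʳ (trans (*-congʳ a*b≈1) (*-identityˡ α)) ⟩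
          α * 1m i j                ∎)) ⟩
      g i j - α * 1m i j                    ∎)
      where open import Relation.Binary.Reasoning.Setoid setoid

    [g-α]^j≈a^j·[h-bα]^j : ∀ j → (g-α ^m j) ≈m ((a ^ j) ·m (h-bα ^m j))
    [g-α]^j≈a^j·[h-bα]^j j = ≈m.trans (^m-cong g-α≈a[h-bα] j) (·m-^m a h-bα j)

    GenEig-scaled⁺ : ∀ v → GenEig g α v → GenEig h (b * α) v
    GenEig-scaled⁺ v (j , [g-α]^j$v≈0) = j , λ i → x*y≈0⇒y≈0 (x≉0⇒x^n≉0 a≉0 j) (begin
      a ^ j * ((h-bα ^m j) $ v) i       ≈⟨ ·m-$ (a ^ j) (h-bα ^m j) v i ⟨
      (((a ^ j) ·m (h-bα ^m j)) $ v) i  ≈⟨ $-cong ([g-α]^j≈a^j·[h-bα]^j j) (λ _ → refl) i ⟨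
      ((g-α ^m j) $ v) i                ≈⟨ [g-α]^j$v≈0 i ⟩
      0#                                ∎)
      where open import Relation.Binary.Reasoning.Setoid setoid

    GenEig-scaled⁻ : ∀ v → GenEig h (b * α) v → GenEig g α v
    GenEig-scaled⁻ v (j , [h-bα]^j$v≈0) = j , λ i → begin
      ((g-α ^m j) $ v) i                ≈⟨ $-cong ([g-α]^j≈a^j·[h-bα]^j j) (λ _ → refl) i ⟩
      (((a ^ j) ·m (h-bα ^m j)) $ v) i  ≈⟨ ·m-$ (a ^ j) (h-bα ^m j) v i ⟩
      a ^ j * ((h-bα ^m j) $ v) i       ≈⟨ *-congˡ ([h-bα]^j$v≈0 i) ⟩
      a ^ j * 0#                        ≈⟨ zeroʳ _ ⟩
      0#                                ∎
      where open import Relation.Binary.Reasoning.Setoid setoid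

    OneDim-scaled : OneDim (GenEig g α) → OneDim (GenEig h (b * α))
    OneDim-scaled (v , v∈Vgα , v≉0 , Vgα⊆⟨v⟩) =
      v , GenEig-scaled⁺ v v∈Vgα , v≉0 , λ w w∈Vhβ → Vgα⊆⟨v⟩ w (GenEig-scaled⁻ w w∈Vhβ)

    IsGenEigProj-scaled : ∀ {P} → IsGenEigProj g α P → IsGenEigProj h (b * α) P
    IsGenEigProj-scaled {P} P-proj u with P-proj u
    ... | Pu∈Vgα , w , [g-α]^n$w≈u-Pu = GenEig-scaled⁺ _ Pu∈Vgα , (a ^ n) ·v w , λ i → begin
      ((h-bα ^m n) $ ((a ^ n) ·v w)) i  ≈⟨ $-·v (a ^ n) (h-bα ^m n) w i ⟩
      a ^ n * ((h-bα ^m n) $ w) i       ≈⟨ ·m-$ (a ^ n) (h-bα ^m n) w i ⟨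
      (((a ^ n) ·m (h-bα ^m n)) $ w) i  ≈⟨ $-cong ([g-α]^j≈a^j·[h-bα]^j n) (λ _ → refl) i ⟨
      ((g-α ^m n) $ w) i                ≈⟨ [g-α]^n$w≈u-Pu i ⟩
      (u -v (P $ u)) i                  ∎
      where open import Relation.Binary.Reasoning.Setoid setoid

module ScalarsInMatrixMonoids {c ℓ} (k : Field c ℓ) (k-finite : IsFinite k) {p : ℕ} (k-char : HasChar k p)
                              (n : ℕ) where

  open import Data.Nat as ℕ using (zero; suc)
  open import Data.Fin using (Fin)
  open import Data.Product using (_,_; proj₁)
  open import Relation.Nullary using (¬_)
  open import Relation.Binary.PropositionalEquality as ≡ using (_≡_)
  open Field k
  open Lin commutativeRing n
  open Matrices commutativeRing n
  open FieldProperties k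
  open FieldOfCharacteristic k k-char using (p∤n⇒n·1≉0)
  open FiniteFieldOfCharacteristic k k-finite k-char using (x≉0⇒∃[N]p∤N∧x^N≈1)

  record IsMatrixMonoid (S : Mat → Set (c ⊔ ℓ)) : Set (c ⊔ ℓ) where
    field
      one : S 1m
      mul : ∀ {M N} → S M → S N → S (M *m N)

    pow : ∀ {M} → S M → ∀ j → S (M ^m j)
    pow x zero    = one
    pow x (suc j) = mul x (pow x j)

  module _ {S : Mat → Set (c ⊔ ℓ)} (S-monoid : IsMatrixMonoid S) where

    open IsMatrixMonoid S-monoid

    module _ {m : ℕ} (H : FinGroup (p ℕ.^ m)) (φ : (M : Mat) → S M → Fin (p ℕ.^ m))
             (φ-resp : ∀ M x N y → M ≈m N → φ M x ≡ φ N y)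
             (φ-hom : ∀ M x N y xy → φ (M *m N) xy ≡ FinGroup._∙_ H (φ M x) (φ N y)) where

      open FinGroup H using (_∙_; e)
      open FiniteGroupOrder H using (group) renaming (_^_ to _^ᴴ_)
      open import Algebra.Properties.Group group using (identityʳ-unique)

      φ-one : φ 1m one ≡ e
      φ-one = identityʳ-unique (φ 1m one) (φ 1m one)
                (≡.trans (≡.sym (φ-hom 1m one 1m one (mul one one))) (φ-resp _ _ 1m one (*m-identityˡ 1m)))

      φ-pow : ∀ {M} (x : S M) j → φ (M ^m j) (pow x j) ≡ φ M x ^ᴴ j
      φ-pow x zero    = φ-one
      φ-pow x (suc j) = ≡.trans (φ-hom _ x _ (pow x j) (pow x (suc j))) (≡.cong (φ _ x ∙_) (φ-pow x j))

      φ-scalar≡e : ∀ {a} → ¬ a ≈ 0# → (s : S (a ·m 1m)) → φ (a ·m 1m) s ≡ e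
      φ-scalar≡e {a} a≉0 s with x≉0⇒∃[N]p∤N∧x^N≈1 a≉0
      ... | N , p∤N , a^N≈1 = PGroups.p∤N∧y^N≡e⇒y≡e (proj₁ k-char) {m} H p∤N _ (begin
        φ (a ·m 1m) s ^ᴴ N                ≡⟨ φ-pow s N ⟨
        φ ((a ·m 1m) ^m N) (pow s N)      ≡⟨ φ-resp _ (pow s N) 1m one (scalar-^m-≈1 {a} {N} a^N≈1) ⟩
        φ 1m one                          ≡⟨ φ-one ⟩
        e                                 ∎)
        where open ≡.≡-Reasoning

    module _ (cc : (M : Mat) → S M → Mat)
             (cc-resp : ∀ M x N y → M ≈m N → cc M x ≈m cc N y)
             (cc-cocycle : ∀ M x N y xy g′ → IsInverse M g′ → cc (M *m N) xy ≈m (cc M x +m ((M *m cc N y) *m g′))) where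

      open import Algebra.Properties.Semiring.Mult semiring using () renaming (_×_ to _·_)
      open import Algebra.Properties.Ring ring using (+-identityʳ-unique)

      cc-one : cc 1m one ≈m 0m
      cc-one i j = +-identityʳ-unique _ _ (begin
        cc 1m one i j + cc 1m one i j                     ≈⟨ +-congˡ (conjugate-by-1m i j) ⟨
        cc 1m one i j + ((1m *m cc 1m one) *m 1m) i j     ≈⟨ cc-cocycle 1m one 1m one (mul one one) 1m 1m-inverse i j ⟨
        cc (1m *m 1m) (mul one one) i j                   ≈⟨ cc-resp _ _ 1m one (*m-identityˡ 1m) i j ⟩
        cc 1m one i j                                     ∎)
        where
          open import Relation.Binary.Reasoning.Setoid setoid
          conjugate-by-1m : ((1m *m cc 1m one) *m 1m) ≈m cc 1m one
          conjugate-by-1m = ≈m.trans (*m-identityʳ (1m *m cc 1m one)) (*m-identityˡ (cc 1m one))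

      cc-scalar-pow : ∀ {a b} → a * b ≈ 1# → (s : S (a ·m 1m)) →
                      ∀ j → cc ((a ·m 1m) ^m j) (pow s j) ≈m ((j · 1#) ·m cc (a ·m 1m) s)
      cc-scalar-pow a*b≈1 s zero i l = trans (cc-one i l) (sym (zeroˡ _))
      cc-scalar-pow {a} {b} a*b≈1 s (suc j) i l = begin
        cc ((a ·m 1m) *m ((a ·m 1m) ^m j)) (pow s (suc j)) i l                  ≈⟨ cc-cocycle _ s _ (pow s j) _ _ s⁻¹-inv i l ⟩
        cc (a ·m 1m) s i l + (((a ·m 1m) *m cc _ (pow s j)) *m (b ·m 1m)) i l   ≈⟨ +-congˡ (scalar-conjugate _ a*b≈1 s⁻¹-inv i l) ⟩
        cc (a ·m 1m) s i l + cc _ (pow s j) i l                                 ≈⟨ +-cong (sym (*-identityˡ _)) (cc-scalar-pow a*b≈1 s j i l) ⟩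
        1# * cc (a ·m 1m) s i l + (j · 1#) * cc (a ·m 1m) s i l                ≈⟨ distribʳ _ 1# (j · 1#) ⟨
        (suc j · 1#) * cc (a ·m 1m) s i l                                       ∎
        where
          open import Relation.Binary.Reasoning.Setoid setoid
          s⁻¹-inv : IsInverse (a ·m 1m) (b ·m 1m)
          s⁻¹-inv = ·m-inverse 1m-inverse a*b≈1

      cc-scalar≈0 : ∀ {a} → ¬ a ≈ 0# → (s : S (a ·m 1m)) → cc (a ·m 1m) s ≈m 0m
      cc-scalar≈0 {a} a≉0 s i l with x≉0⇒∃[N]p∤N∧x^N≈1 a≉0 | unit-inverse a≉0
      ... | N , p∤N , a^N≈1 | b , a*b≈1 , _ = x*y≈0⇒y≈0 (p∤n⇒n·1≉0 p∤N) (begin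
        (N · 1#) * cc (a ·m 1m) s i l          ≈⟨ cc-scalar-pow a*b≈1 s N i l ⟨
        cc ((a ·m 1m) ^m N) (pow s N) i l      ≈⟨ cc-resp _ (pow s N) 1m one (scalar-^m-≈1 {a} {N} a^N≈1) i l ⟩
        cc 1m one i l                          ≈⟨ cc-one i l ⟩
        0#                                     ∎)
        where open import Relation.Binary.Reasoning.Setoid setoid

module ScalarExtension {c ℓ} (k : Field c ℓ) (k-finite : IsFinite k) {p : ℕ} (k-char : HasChar k p) (n : ℕ)
                       (G : Lin.Mat (Field.commutativeRing k) n → Set (c ⊔ ℓ)) (G-subgroup : IsSubgroupGL k n G) where

  open import Data.Nat as ℕ using ()
  open import Data.Fin using (Fin)
  open import Data.Product using (Σ; _×_; _,_)
  open import Relation.Nullary using (¬_)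
  open import Relation.Binary.PropositionalEquality as ≡ using (_≡_)
  open import Algebra.Structures using (module IsGroup)
  open import Function.Bundles using (_⇔_; mk⇔; Equivalence)
  open Field k
  open Lin commutativeRing n
  open Matrices commutativeRing n
  open FieldProperties k
  open ScalarsInMatrixMonoids k k-finite k-char n
  open ScaledEigenspaces k n
  module G = IsSubgroupGL G-subgroup

  kˣG : Mat → Set (c ⊔ ℓ)
  kˣG = scalarsTimes k n G

  G-monoid : IsMatrixMonoid G
  G-monoid = record { one = G.one ; mul = G.mul }

  G⊆kˣG : ∀ {M} → G M → kˣG M
  G⊆kˣG {M} x = 1# , 1≉0 , M , x , λ i j → sym (*-identityˡ _)

  scalar∈kˣG : ∀ {a} → ¬ a ≈ 0# → kˣG (a ·m 1m)
  scalar∈kˣG {a} a≉0 = a , a≉0 , 1m , G.one , ≈m.refl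

  kˣG-monoid : IsMatrixMonoid kˣG
  kˣG-monoid = record
    { one = G⊆kˣG G.one
    ; mul = λ { (a , a≉0 , g , x , M≈ag) (b , b≉0 , h , y , N≈bh) →
        a * b , x≉0∧y≉0⇒x*y≉0 a≉0 b≉0 , g *m h , G.mul x y , *m-factors M≈ag N≈bh }
    }

  scalar-ratio : ∀ {a b h h′} → ¬ a ≈ 0# → ¬ b ≈ 0# → G h → G h′ → (a ·m h) ≈m (b ·m h′) →
                 Σ Carrier λ c → ¬ c ≈ 0# × G (c ·m 1m) × h′ ≈m ((c ·m 1m) *m h)
  scalar-ratio {a} {b} {h} {h′} a≉0 b≉0 x x′ ah≈bh′ with unit-inverse b≉0
  ... | b⁻¹ , b*b⁻¹≈1 , b⁻¹≉0 = b⁻¹ * a , x≉0∧y≉0⇒x*y≉0 b⁻¹≉0 a≉0 , c∈G , h′≈ch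
    where
      open ≈m-Reasoning
      h′≈ch : h′ ≈m (((b⁻¹ * a) ·m 1m) *m h)
      h′≈ch = begin
        h′                        ≈⟨ ·m-identity h′ ⟨
        1# ·m h′                  ≈⟨ ·m-cong (trans (sym b*b⁻¹≈1) (*-comm b b⁻¹)) ≈m.refl ⟩
        (b⁻¹ * b) ·m h′           ≈⟨ ·m-·m b⁻¹ b h′ ⟨
        b⁻¹ ·m (b ·m h′)          ≈⟨ ·m-cong refl ah≈bh′ ⟨
        b⁻¹ ·m (a ·m h)           ≈⟨ ·m-·m b⁻¹ a h ⟩
        (b⁻¹ * a) ·m h            ≈⟨ scalar-*m (b⁻¹ * a) h ⟨
        ((b⁻¹ * a) ·m 1m) *m h    ∎
      c∈G : G ((b⁻¹ * a) ·m 1m)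
      c∈G with G.inv x
      ... | h⁻¹ , (h*h⁻¹≈1 , _) , x⁻¹ = G.resp (begin
        h′ *m h⁻¹                              ≈⟨ *m-cong h′≈ch ≈m.refl ⟩
        (((b⁻¹ * a) ·m 1m) *m h) *m h⁻¹        ≈⟨ *m-assoc _ h h⁻¹ ⟩
        ((b⁻¹ * a) ·m 1m) *m (h *m h⁻¹)        ≈⟨ *m-cong ≈m.refl h*h⁻¹≈1 ⟩
        ((b⁻¹ * a) ·m 1m) *m 1m                ≈⟨ *m-identityʳ _ ⟩
        (b⁻¹ * a) ·m 1m                        ∎) (G.mul x′ x⁻¹)

  module _ {m : ℕ} (H : FinGroup (p ℕ.^ m)) (φ : (M : Mat) → G M → Fin (p ℕ.^ m))
           (φ-resp : ∀ M x N y → M ≈m N → φ M x ≡ φ N y)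
           (φ-hom : ∀ M x N y xy → φ (M *m N) xy ≡ FinGroup._∙_ H (φ M x) (φ N y)) where

    open FinGroup H using (_∙_; e)
    open IsGroup (FinGroup.isGroup H) using (identityˡ)
    open ≡.≡-Reasoning

    φ-scalar-invariant : ∀ {a b h h′} (x : G h) (x′ : G h′) → ¬ a ≈ 0# → ¬ b ≈ 0# →
                         (a ·m h) ≈m (b ·m h′) → φ h x ≡ φ h′ x′
    φ-scalar-invariant {h = h} {h′} x x′ a≉0 b≉0 ah≈bh′ with scalar-ratio a≉0 b≉0 x x′ ah≈bh′
    ... | c , c≉0 , s , h′≈ch = ≡.sym (begin
      φ h′ x′                          ≡⟨ φ-resp h′ x′ _ (G.mul s x) h′≈ch ⟩
      φ ((c ·m 1m) *m h) (G.mul s x)   ≡⟨ φ-hom _ s h x (G.mul s x) ⟩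
      φ (c ·m 1m) s ∙ φ h x            ≡⟨ ≡.cong (_∙ φ h x) (φ-scalar≡e G-monoid {m} H φ φ-resp φ-hom c≉0 s) ⟩
      e ∙ φ h x                        ≡⟨ identityˡ (φ h x) ⟩
      φ h x                            ∎)

  B1⇔ : B1 k n p G ⇔ B1 k n p kˣG
  B1⇔ = mk⇔ restrict extend
    where
      restrict : B1 k n p G → B1 k n p kˣG
      restrict G-B1 m 1≤m H φ φ-resp φ-hom φ-surjective =
        G-B1 m 1≤m H (λ M x → φ M (G⊆kˣG x)) (λ M x N y → φ-resp M (G⊆kˣG x) N (G⊆kˣG y))
             (λ M x N y xy → φ-hom M (G⊆kˣG x) N (G⊆kˣG y) (G⊆kˣG xy)) restriction-surjective
        where
          open FinGroup H using (_∙_; e)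
          open IsGroup (FinGroup.isGroup H) using (identityˡ)
          open ≡.≡-Reasoning
          restriction-surjective : ∀ z → Σ Mat λ M → Σ (G M) λ x → φ M (G⊆kˣG x) ≡ z
          restriction-surjective z with φ-surjective z
          ... | M , w@(a , a≉0 , h , x , M≈ah) , φw≡z = h , x , (begin
            φ h x̂                          ≡⟨ identityˡ _ ⟨
            e ∙ φ h x̂                      ≡⟨ ≡.cong (_∙ φ h x̂) (φ-scalar≡e kˣG-monoid {m} H φ φ-resp φ-hom a≉0 s) ⟨
            φ (a ·m 1m) s ∙ φ h x̂          ≡⟨ φ-hom _ s h x̂ (mul s x̂) ⟨
            φ ((a ·m 1m) *m h) (mul s x̂)   ≡⟨ φ-resp _ _ M w (≈m.trans (scalar-*m a h) (≈m.sym M≈ah)) ⟩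
            φ M w                          ≡⟨ φw≡z ⟩
            z                              ∎)
            where
              open IsMatrixMonoid kˣG-monoid using (mul)
              x̂ : kˣG h
              x̂ = G⊆kˣG x
              s : kˣG (a ·m 1m)
              s = scalar∈kˣG a≉0

      extend : B1 k n p kˣG → B1 k n p G
      extend kˣG-B1 m 1≤m H φ φ-resp φ-hom φ-surjective =
        kˣG-B1 m 1≤m H φ̂ φ̂-resp φ̂-hom λ z → let (M , x , φx≡z) = φ-surjective z in M , G⊆kˣG x , φx≡z
        where
          open FinGroup H using (_∙_)
          φ̂ : (M : Mat) → kˣG M → Fin (p ℕ.^ m)
          φ̂ M (_ , _ , h , x , _) = φ h x
          φ̂-resp : ∀ M x N y → M ≈m N → φ̂ M x ≡ φ̂ N y
          φ̂-resp M (a , a≉0 , g , x , M≈ag) N (b , b≉0 , h , y , N≈bh) M≈N =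
            φ-scalar-invariant {m} H φ φ-resp φ-hom x y a≉0 b≉0 (≈m.trans (≈m.sym M≈ag) (≈m.trans M≈N N≈bh))
          φ̂-hom : ∀ M x N y xy → φ̂ (M *m N) xy ≡ φ̂ M x ∙ φ̂ N y
          φ̂-hom M (a , a≉0 , g , x , M≈ag) N (b , b≉0 , h , y , N≈bh) (c , c≉0 , gh′ , z , MN≈cgh′) =
            ≡.trans (φ-scalar-invariant {m} H φ φ-resp φ-hom z (G.mul x y) c≉0 (x≉0∧y≉0⇒x*y≉0 a≉0 b≉0)
                       (≈m.trans (≈m.sym MN≈cgh′) (*m-factors M≈ag N≈bh)))
                    (φ-hom g x h y (G.mul x y))

  B2⇔ : B2 k n p G ⇔ B2 k n p kˣG
  B2⇔ = mk⇔ restrict extend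
    where
      restrict : B2 k n p G → B2 k n p kˣG
      restrict G-B2 K ι ι-hom with G-B2 K ι ι-hom
      ... | v≉0 , G-irreducible = v≉0 , λ W W-subspace W-stable →
        G-irreducible W W-subspace λ N (M , x , N≈ιM) → W-stable N (M , G⊆kˣG x , N≈ιM)

      extend : B2 k n p kˣG → B2 k n p G
      extend kˣG-B2 K ι ι-hom with kˣG-B2 K ι ι-hom
      ... | v≉0 , kˣG-irreducible = v≉0 , λ W W-subspace W-stable →
        kˣG-irreducible W W-subspace (kˣG-stable W W-subspace W-stable)
        where
          module K = Field K
          module KL = Lin K.commutativeRing n
          module KM = Matrices K.commutativeRing n
          module ι = RingMorphisms.IsRingHomomorphism ι-hom
          ι-map : Mat → KL.Mat
          ι-map = mapMat {R = K.commutativeRing} {R' = commutativeRing} ι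

          kˣG-stable : ∀ W → KL.IsSubspaceV W →
                       (∀ N → (Σ Mat λ M → G M × KL._≈m_ N (ι-map M)) → ∀ v → W v → W (N KL.$ v)) →
                       (∀ N → (Σ Mat λ M → kˣG M × KL._≈m_ N (ι-map M)) → ∀ v → W v → W (N KL.$ v))
          kˣG-stable W (W-resp , _ , _ , W-scale) W-stable N (M , (a , _ , h , x , M≈ah) , N≈ιM) v v∈W =
            W-resp ι[a]·ιh$v≈N$v (W-scale (ι a) (W-stable (ι-map h) (h , x , KM.≈m.refl) v v∈W))
            where
              N≈ι[a]·ιh : KL._≈m_ N (ι a KL.·m ι-map h)
              N≈ι[a]·ιh i j = K.trans (N≈ιM i j) (K.trans (ι.⟦⟧-cong (M≈ah i j)) (ι.*-homo a (h i j)))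
              ι[a]·ιh$v≈N$v : KL._≈v_ (ι a KL.·v (ι-map h KL.$ v)) (N KL.$ v)
              ι[a]·ιh$v≈N$v i = K.sym (K.trans (KM.$-cong N≈ι[a]·ιh (λ _ → K.refl) i) (KM.·m-$ (ι a) (ι-map h) v i))

  module _ (cc : (M : Mat) → G M → Mat)
           (cc-resp : ∀ M x N y → M ≈m N → cc M x ≈m cc N y)
           (cc-cocycle : ∀ M x N y xy g′ → IsInverse M g′ → cc (M *m N) xy ≈m (cc M x +m ((M *m cc N y) *m g′))) where

    open import Relation.Binary.Reasoning.Setoid setoid

    cc-scalar-invariant : ∀ {a b h h′} (x : G h) (x′ : G h′) → ¬ a ≈ 0# → ¬ b ≈ 0# →
                          (a ·m h) ≈m (b ·m h′) → cc h x ≈m cc h′ x′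
    cc-scalar-invariant {h = h} {h′} x x′ a≉0 b≉0 ah≈bh′ i j with scalar-ratio a≉0 b≉0 x x′ ah≈bh′
    ... | c , c≉0 , s , h′≈ch with unit-inverse c≉0
    ...   | d , c*d≈1 , _ = sym (begin
      cc h′ x′ i j                                                  ≈⟨ cc-resp h′ x′ _ (G.mul s x) h′≈ch i j ⟩
      cc ((c ·m 1m) *m h) (G.mul s x) i j                           ≈⟨ cc-cocycle _ s h x (G.mul s x) _ s⁻¹-inv i j ⟩
      cc (c ·m 1m) s i j + (((c ·m 1m) *m cc h x) *m (d ·m 1m)) i j ≈⟨ +-cong (cc-scalar≈0 G-monoid cc cc-resp cc-cocycle c≉0 s i j)
                                                                               (scalar-conjugate (cc h x) c*d≈1 s⁻¹-inv i j) ⟩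
      0# + cc h x i j                                               ≈⟨ +-identityˡ _ ⟩
      cc h x i j                                                    ∎)
      where
        s⁻¹-inv : IsInverse (c ·m 1m) (d ·m 1m)
        s⁻¹-inv = ·m-inverse 1m-inverse c*d≈1

  B3⇔ : B3 k n p G ⇔ B3 k n p kˣG
  B3⇔ = mk⇔ restrict extend
    where
      open import Relation.Binary.Reasoning.Setoid setoid

      restrict : B3 k n p G → B3 k n p kˣG
      restrict G-B3 cc cc-trace cc-resp cc-cocycle with
        G-B3 (λ M x → cc M (G⊆kˣG x)) (λ M x → cc-trace M (G⊆kˣG x))
             (λ M x N y → cc-resp M (G⊆kˣG x) N (G⊆kˣG y))
             (λ M x N y xy → cc-cocycle M (G⊆kˣG x) N (G⊆kˣG y) (G⊆kˣG xy))
      ... | X , trX≈0 , cc≈coboundary = X , trX≈0 , kˣG-coboundary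
        where
          open IsMatrixMonoid kˣG-monoid using (mul)
          kˣG-coboundary : ∀ M w g′ → IsInverse M g′ → cc M w ≈m (((M *m X) *m g′) -m X)
          kˣG-coboundary M w@(a , a≉0 , h , x , M≈ah) g′ g′-inv i j with unit-inverse a≉0 | G.inv x
          ... | b , a*b≈1 , _ | h⁻¹ , h⁻¹-inv , _ = begin
            cc M w i j                                                ≈⟨ cc-resp M w _ (mul s x̂) M≈[a·1]h i j ⟩
            cc ((a ·m 1m) *m h) (mul s x̂) i j                         ≈⟨ cc-cocycle _ s h x̂ _ _ s⁻¹-inv i j ⟩
            cc (a ·m 1m) s i j + (((a ·m 1m) *m cc h x̂) *m (b ·m 1m)) i j
                                                                      ≈⟨ +-cong (cc-scalar≈0 kˣG-monoid cc cc-resp cc-cocycle a≉0 s i j)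
                                                                                (scalar-conjugate (cc h x̂) a*b≈1 s⁻¹-inv i j) ⟩
            0# + cc h x̂ i j                                           ≈⟨ +-identityˡ _ ⟩
            cc h x̂ i j                                                ≈⟨ cc≈coboundary h x h⁻¹ h⁻¹-inv i j ⟩
            ((h *m X) *m h⁻¹) i j - X i j                             ≈⟨ +-congʳ (conjugate-·m X M≈ah a*b≈1 g′-inv h⁻¹-inv i j) ⟨
            ((M *m X) *m g′) i j - X i j                              ∎
            where
              x̂ : kˣG h
              x̂ = G⊆kˣG x
              s : kˣG (a ·m 1m)
              s = scalar∈kˣG a≉0
              s⁻¹-inv : IsInverse (a ·m 1m) (b ·m 1m)
              s⁻¹-inv = ·m-inverse 1m-inverse a*b≈1
              M≈[a·1]h : M ≈m ((a ·m 1m) *m h)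
              M≈[a·1]h = ≈m.trans M≈ah (≈m.sym (scalar-*m a h))

      extend : B3 k n p kˣG → B3 k n p G
      extend kˣG-B3 cc cc-trace cc-resp cc-cocycle with kˣG-B3 ĉc ĉc-trace ĉc-resp ĉc-cocycle
        where
          ĉc : (M : Mat) → kˣG M → Mat
          ĉc M (_ , _ , h , x , _) = cc h x
          ĉc-trace : ∀ M w → trace (ĉc M w) ≈ 0#
          ĉc-trace M (_ , _ , h , x , _) = cc-trace h x
          ĉc-resp : ∀ M w N w′ → M ≈m N → ĉc M w ≈m ĉc N w′
          ĉc-resp M (a , a≉0 , g , x , M≈ag) N (b , b≉0 , h , y , N≈bh) M≈N =
            cc-scalar-invariant cc cc-resp cc-cocycle x y a≉0 b≉0 (≈m.trans (≈m.sym M≈ag) (≈m.trans M≈N N≈bh))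
          ĉc-cocycle : ∀ M w N w′ ww′ g′ → IsInverse M g′ → ĉc (M *m N) ww′ ≈m (ĉc M w +m ((M *m ĉc N w′) *m g′))
          ĉc-cocycle M (a , a≉0 , g , x , M≈ag) N (b , b≉0 , h , y , N≈bh) (c , c≉0 , gh′ , z , MN≈cgh′) g′ g′-inv i j
            with unit-inverse a≉0 | G.inv x
          ... | a⁻¹ , a*a⁻¹≈1 , _ | g⁻¹ , g⁻¹-inv , _ = begin
            cc gh′ z i j                                  ≈⟨ cc-scalar-invariant cc cc-resp cc-cocycle z (G.mul x y) c≉0 ab≉0
                                                                (≈m.trans (≈m.sym MN≈cgh′) (*m-factors M≈ag N≈bh)) i j ⟩
            cc (g *m h) (G.mul x y) i j                   ≈⟨ cc-cocycle g x h y (G.mul x y) g⁻¹ g⁻¹-inv i j ⟩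
            cc g x i j + ((g *m cc h y) *m g⁻¹) i j       ≈⟨ +-congˡ (conjugate-·m (cc h y) M≈ag a*a⁻¹≈1 g′-inv g⁻¹-inv i j) ⟨
            cc g x i j + ((M *m cc h y) *m g′) i j        ∎
            where
              ab≉0 : ¬ a * b ≈ 0#
              ab≉0 = x≉0∧y≉0⇒x*y≉0 a≉0 b≉0
      ... | X , trX≈0 , ĉc≈coboundary = X , trX≈0 , λ M x → ĉc≈coboundary M (G⊆kˣG x)

  Stable-kˣG⇒G : ∀ W → Stable k n p kˣG W → Stable k n p G W
  Stable-kˣG⇒G W W-stable g g⁻¹ x = W-stable g g⁻¹ (G⊆kˣG x)

  Stable-G⇒kˣG : ∀ W → IsSubspaceM W → Stable k n p G W → Stable k n p kˣG W
  Stable-G⇒kˣG W (W-resp , _) W-stable g g⁻¹ (a , a≉0 , h , x , g≈ah) g⁻¹-inv f f∈W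
    with unit-inverse a≉0 | G.inv x
  ... | b , a*b≈1 , _ | h⁻¹ , h⁻¹-inv , _ =
    W-resp (≈m.sym (conjugate-·m f g≈ah a*b≈1 g⁻¹-inv h⁻¹-inv)) (W-stable h h⁻¹ x h⁻¹-inv f f∈W)

  IsIrredSubmodule⇔ : ∀ W → IsIrredSubmodule k n p G W ⇔ IsIrredSubmodule k n p kˣG W
  IsIrredSubmodule⇔ W = mk⇔
    (λ (W-subspace , W-stable , W≢0 , W-minimal) → W-subspace , Stable-G⇒kˣG W W-subspace W-stable , W≢0 ,
       λ U U-subspace U-stable → W-minimal U U-subspace (Stable-kˣG⇒G U U-stable))
    (λ (W-subspace , W-stable , W≢0 , W-minimal) → W-subspace , Stable-kˣG⇒G W W-stable , W≢0 ,
       λ U U-subspace U-stable → W-minimal U U-subspace (Stable-G⇒kˣG U U-subspace U-stable))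

  B4⇔ : B4 k n p G ⇔ B4 k n p kˣG
  B4⇔ = mk⇔ restrict extend
    where
      restrict : B4 k n p G → B4 k n p kˣG
      restrict G-B4 W W-irreducible with G-B4 W (Equivalence.from (IsIrredSubmodule⇔ W) W-irreducible)
      ... | g , x , rest = g , G⊆kˣG x , rest

      extend : B4 k n p kˣG → B4 k n p G
      extend kˣG-B4 W W-irreducible with kˣG-B4 W (Equivalence.to (IsIrredSubmodule⇔ W) W-irreducible)
      ... | g , (a , a≉0 , h , x , g≈ah) , α , f , f∈W , Vgα-line , P , P-proj , v , v∈Vgα , Pfv≉0
        with unit-inverse a≉0
      ...   | b , a*b≈1 , _ =
        h , x , b * α , f , f∈W , OneDim-scaled a≉0 g≈ah a*b≈1 α Vgα-line ,
        P , IsGenEigProj-scaled a≉0 g≈ah a*b≈1 α P-proj , v , GenEig-scaled⁺ a≉0 g≈ah a*b≈1 α v v∈Vgα , Pfv≉0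

proposition2p2 : ∀ {c ℓ} (k : Field c ℓ) → IsFinite k →
    (p : ℕ) → HasChar k p → (n : ℕ) →
    (G : Lin.Mat (Field.commutativeRing k) n → Set (c ⊔ ℓ)) →
    IsSubgroupGL k n G →
    (Big k n p G ⇔ Big k n p (scalarsTimes k n G))
proposition2p2 k k-finite p k-char n G G-subgroup = B1⇔ ×-⇔ B2⇔ ×-⇔ B3⇔ ×-⇔ B4⇔
  where open ScalarExtension k k-finite k-char n G G-subgroup
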